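{- The algorithm LASSP runs only a single iteration of its repeat-loop with probability at least $1 - 1/d$.
   Context: $[d] = \{1,\dots,d\}$; for $\Omega \subseteq [d]$, $\mathrm{sep}(\Omega) = \min_{i\neq j\in\Omega}|i-j|$, $\mathbb{M}_\Delta = \{\Omega \subseteq [d] : \mathrm{sep}(\Omega)\ge\Delta\}$; $k,\Delta$ positive integers. $\mathrm{ProjLagr}(\lambda,\tilde c) := \arg\max_{S \in \mathbb{M}_\Delta} \left(\sum_{i\in S}\tilde c_i + \lambda(k - |S|)\right)$. Algorithm LASSP (input $c \in \mathbb{Z}^d$ (non-negative), $k \in \mathbb{N}_+$): repeat: (1) choose $X \in \mathbb{Z}^d$ with the $X_i$ independent and uniform on $\{0,\dots,d^3-1\}$; (2) set $\tilde c := d^4 c + X$; (3) let $\hat\lambda \in \mathbb{Z}$ minimize over $\lambda\in\mathbb{Z}$ the optimal value of $\mathrm{ProjLagr}(\lambda,\tilde c)$, taking the largest minimizer in case of ties; (4) choose $\hat S \in \mathrm{ProjLagr}(\hat\lambda - \tfrac{1}{d+1}, \tilde c)$; until $|\hat S| = k$; return $\hat S$. -}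

module Defs where

open import Data.Nat as ℕ using (ℕ; zero; suc; _^_; ∣_-_∣)
open import Data.Integer as ℤ using (ℤ; +_)
open import Data.Rational as ℚ using (ℚ; _/_)
open import Data.Fin using (Fin; toℕ)
open import Data.Fin.Subset using (Subset; _∈_; ∣_∣)
open import Data.Vec as Vec using (Vec; []; _∷_; lookup)
open import Data.List as List using (List; allFin; concatMap; map; filter; length)
open import Data.Nat.ListAction using (sum)
open import Data.Bool using (if_then_else_)
open import Data.Product using (_×_; ∃)
open import Relation.Binary.PropositionalEquality using (_≡_)
open import Relation.Nullary using (¬_)

-- Indices 1..d are represented by Fin d (i ↦ toℕ i + 1); differences are unaffected.
-- A subset Ω ⊆ [d] is a Data.Fin.Subset d (characteristic Bool vector).

-- Ω ∈ 𝕄_Δ  ⇔  sep(Ω) ≥ Δ, where sep(Ω) = min_{i≠j∈Ω} |i-j|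
-- (min over the empty set is +∞, so sets with ≤ 1 element are in 𝕄_Δ).
InM : {d : ℕ} → ℕ → Subset d → Set
InM {d} Δ Ω = (i j : Fin d) → i ∈ Ω → j ∈ Ω → ¬ (i ≡ j) → Δ ℕ.≤ ∣ toℕ i - toℕ j ∣

sumOver : {d : ℕ} → Subset d → Vec ℕ d → ℕ
sumOver {d} S x = sum (map (λ i → if lookup S i then lookup x i else 0) (allFin d))

lagr : {d : ℕ} → ℕ → ℚ → Vec ℕ d → Subset d → ℚ
lagr k lam c̃ S = ((+ sumOver S c̃) / 1) ℚ.+ lam ℚ.* ((+ k ℤ.- + ∣ S ∣) / 1)

InProjLagr : {d : ℕ} → ℕ → ℕ → ℚ → Vec ℕ d → Subset d → Set
InProjLagr {d} Δ k lam c̃ S = InM Δ S × ((T : Subset d) → InM Δ T → lagr k lam c̃ T ℚ.≤ lagr k lam c̃ S)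

OptVal : {d : ℕ} → ℕ → ℕ → ℚ → Vec ℕ d → ℚ → Set
OptVal {d} Δ k lam c̃ v = (∃ λ S → InM Δ S × lagr k lam c̃ S ≡ v)
                     × ((T : Subset d) → InM Δ T → lagr k lam c̃ T ℚ.≤ v)

-- λ̂ ∈ ℤ minimizes λ ↦ (optimal value of ProjLagr(λ, c̃)) over ℤ, and is the largest minimizer.
IsLambdaHat : {d : ℕ} → ℕ → ℕ → Vec ℕ d → ℤ → Set
IsLambdaHat Δ k c̃ lh = (μ : ℤ) (v w : ℚ) → OptVal Δ k (lh / 1) c̃ v → OptVal Δ k (μ / 1) c̃ w
                      → (v ℚ.≤ w) × (w ℚ.≤ v → μ ℤ.≤ lh)

perturb : {d : ℕ} → Vec ℕ d → Vec (Fin (d ^ 3)) d → Vec ℕ d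
perturb {d} c X = Vec.zipWith (λ ci xi → d ^ 4 ℕ.* ci ℕ.+ toℕ xi) c X

-- The list of all vectors in {0,…,m-1}^n (each exactly once): the sample space of X.
allVecs : (n m : ℕ) → List (Vec (Fin m) n)
allVecs zero m = [] List.∷ List.[]
allVecs (suc n) m = concatMap (λ x → map (x ∷_) (allVecs n m)) (allFin m)

module Submission where

-- Fix X, the perturbed weights c̃ = d⁴c + X, μ = λ̂ and Ŝ, the maximiser at μ - 1/(d + 1).
-- 1. Exchange (module Exchange). If P, Q ∈ 𝕄_Δ and |Q| ≥ |P| + 2, some window of positions,
--    bounded by cuts across which P and Q can be glued, holds exactly one more element of Q than
--    of P; swapping it gives C, D ∈ 𝕄_Δ with |C| = |P| + 1, |D| = |Q| - 1, the same total
--    weight, and a position in C ∖ D.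
-- 2. Dichotomy (modules Lagrangian, Descent, Dichotomy). Comparing Lagrangian values at
--    μ - 1/(d + 1), μ - 1 and μ + 1 (μ is the largest minimiser of the dual value) and
--    exchanging repeatedly with an optimal k-set yields |Ŝ| = k, or else a (k+1)-set and a
--    (k-1)-set which exchange into two optimal k-sets differing at some position i: a tie at i.
-- 3. Counting (modules Perturbation, Sampling, Analysis). Moving X_i shifts exactly the weights
--    of the sets containing i, so once the other coordinates are fixed at most one value of X_i
--    gives a tie at i. Hence at most d (d³)^(d-1) samples fail, and d² ≤ d³ gives the bound.

open import Defs
open import Data.Nat as ℕ using (ℕ; suc; _^_; _∸_)
open import Data.Nat.Properties using (_≟_)
import Data.Nat.Properties as ℕP
import Data.Integer.Properties as ℤP
import Data.Rational.Properties as ℚP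
open import Data.Integer as ℤ using (ℤ)
open import Data.Rational as ℚ using (ℚ; _/_)
open import Data.Bool using (Bool; true; false)
open import Data.Fin.Subset using (Subset; ∣_∣)
open import Data.Vec using (Vec)
open import Data.List using (filter; length)
open import Data.Product using (Σ; ∃; _×_; _,_)
open import Function using (_∘_)
open import Relation.Binary.PropositionalEquality using (_≡_; cong; sym)
open import Relation.Nullary using (Dec; does)
open import Relation.Nullary.Decidable using (dec-true)

bit : Bool → ℕ
bit true = 1
bit false = 0

indicator : ∀ {A : Set} → Dec A → ℕ
indicator = bit ∘ does

indicator-yes : ∀ {A : Set} (a? : Dec A) → A → indicator a? ≡ 1
indicator-yes a? a = cong bit (dec-true a? a)

module ListSums where
  open import Data.Nat
  open import Data.Nat.Properties
  open import Data.Nat.ListAction using (sum)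
  open import Data.Nat.Tactic.RingSolver using (solve-∀)
  open import Algebra.Properties.CommutativeSemigroup +-commutativeSemigroup using (interchange)
  open import Data.List using (List; []; _∷_; _++_; map; concatMap; tabulate)
  open import Data.List.Membership.Propositional using (_∈_)
  open import Data.List.Relation.Unary.Any using (here; there)
  open import Data.Fin using (Fin) renaming (zero to fz; suc to fs)
  import Data.Fin.Properties as FinP
  open import Relation.Binary.PropositionalEquality
  open import Relation.Nullary using (yes; no)
  open import Relation.Unary using (Decidable)

  sumBy : ∀ {A : Set} → (A → ℕ) → List A → ℕ
  sumBy f [] = 0
  sumBy f (x ∷ xs) = f x + sumBy f xs

  sum-map : ∀ {A : Set} (f : A → ℕ) xs → sum (map f xs) ≡ sumBy f xs
  sum-map f [] = refl
  sum-map f (x ∷ xs) = cong (f x +_) (sum-map f xs)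

  sumBy-cong : ∀ {A : Set} {f g : A → ℕ} xs → (∀ x → f x ≡ g x) → sumBy f xs ≡ sumBy g xs
  sumBy-cong [] h = refl
  sumBy-cong (x ∷ xs) h = cong₂ _+_ (h x) (sumBy-cong xs h)

  sumBy-mono : ∀ {A : Set} {f g : A → ℕ} xs → (∀ x → f x ≤ g x) → sumBy f xs ≤ sumBy g xs
  sumBy-mono [] h = z≤n
  sumBy-mono (x ∷ xs) h = +-mono-≤ (h x) (sumBy-mono xs h)

  sumBy-const : ∀ {A : Set} (c : ℕ) (xs : List A) → sumBy (λ _ → c) xs ≡ length xs * c
  sumBy-const c [] = refl
  sumBy-const c (x ∷ xs) = cong (c +_) (sumBy-const c xs)

  sumBy-+ : ∀ {A : Set} (f g : A → ℕ) xs → sumBy (λ x → f x + g x) xs ≡ sumBy f xs + sumBy g xs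
  sumBy-+ f g [] = refl
  sumBy-+ f g (x ∷ xs) =
    trans (cong (f x + g x +_) (sumBy-+ f g xs)) (interchange (f x) (g x) (sumBy f xs) (sumBy g xs))

  sumBy-++ : ∀ {A : Set} (f : A → ℕ) xs ys → sumBy f (xs ++ ys) ≡ sumBy f xs + sumBy f ys
  sumBy-++ f [] ys = refl
  sumBy-++ f (x ∷ xs) ys = trans (cong (f x +_) (sumBy-++ f xs ys)) (sym (+-assoc (f x) _ _))

  sumBy-map : ∀ {A B : Set} (f : B → ℕ) (g : A → B) xs → sumBy f (map g xs) ≡ sumBy (f ∘ g) xs
  sumBy-map f g [] = refl
  sumBy-map f g (x ∷ xs) = cong (f (g x) +_) (sumBy-map f g xs)

  sumBy-concatMap : ∀ {A B : Set} (f : B → ℕ) (g : A → List B) xs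
                  → sumBy f (concatMap g xs) ≡ sumBy (λ x → sumBy f (g x)) xs
  sumBy-concatMap f g [] = refl
  sumBy-concatMap f g (x ∷ xs) = trans (sumBy-++ f (g x) (concatMap g xs)) (cong (sumBy f (g x) +_) (sumBy-concatMap f g xs))

  sumBy-swap : ∀ {A B : Set} (h : A → B → ℕ) xs ys
             → sumBy (λ x → sumBy (h x) ys) xs ≡ sumBy (λ y → sumBy (λ x → h x y) xs) ys
  sumBy-swap h [] ys = sym (trans (sumBy-const 0 ys) (*-zeroʳ (length ys)))
  sumBy-swap h (x ∷ xs) ys =
    trans (cong (sumBy (h x) ys +_) (sumBy-swap h xs ys)) (sym (sumBy-+ (h x) (λ y → sumBy (λ x → h x y) xs) ys))

  sumBy-member : ∀ {A : Set} (f : A → ℕ) {x} xs → x ∈ xs → f x ≤ sumBy f xs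
  sumBy-member f (y ∷ ys) (here refl) = m≤m+n (f y) _
  sumBy-member f (y ∷ ys) (there x∈ys) = ≤-trans (sumBy-member f ys x∈ys) (m≤n+m _ (f y))

  length-filter : ∀ {A : Set} {P : A → Set} (P? : Decidable P) xs
                → length (filter P? xs) ≡ sumBy (indicator ∘ P?) xs
  length-filter P? [] = refl
  length-filter P? (x ∷ xs) with P? x
  ... | yes _ = cong suc (length-filter P? xs)
  ... | no _ = length-filter P? xs

  ΣFin : ∀ d → (Fin d → ℕ) → ℕ
  ΣFin zero f = 0
  ΣFin (suc d) f = f fz + ΣFin d (f ∘ fs)

  sumBy-tabulate : ∀ {A : Set} {d} (f : A → ℕ) (g : Fin d → A) → sumBy f (tabulate g) ≡ ΣFin d (f ∘ g)
  sumBy-tabulate {d = zero} f g = refl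
  sumBy-tabulate {d = suc d} f g = cong (f (g fz) +_) (sumBy-tabulate f (g ∘ fs))

  ΣFin-cong : ∀ d {f g : Fin d → ℕ} → (∀ j → f j ≡ g j) → ΣFin d f ≡ ΣFin d g
  ΣFin-cong zero h = refl
  ΣFin-cong (suc d) h = cong₂ _+_ (h fz) (ΣFin-cong d (h ∘ fs))

  ΣFin-change : ∀ d (f g : Fin d → ℕ) i → (∀ j → j ≢ i → f j ≡ g j) → ΣFin d f + g i ≡ ΣFin d g + f i
  ΣFin-change (suc d) f g fz same = begin
    f fz + ΣFin d (f ∘ fs) + g fz ≡⟨ cong (λ r → f fz + r + g fz) (ΣFin-cong d (λ j → same (fs j) (λ ()))) ⟩
    f fz + ΣFin d (g ∘ fs) + g fz ≡⟨ interchange′ (f fz) (ΣFin d (g ∘ fs)) (g fz) ⟩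
    g fz + ΣFin d (g ∘ fs) + f fz ∎
    where
    open ≡-Reasoning
    interchange′ : ∀ a r b → a + r + b ≡ b + r + a
    interchange′ = solve-∀
  ΣFin-change (suc d) f g (fs i) same = begin
    f fz + ΣFin d (f ∘ fs) + g (fs i)   ≡⟨ +-assoc (f fz) _ _ ⟩
    f fz + (ΣFin d (f ∘ fs) + g (fs i)) ≡⟨ cong₂ _+_ (same fz (λ ())) (ΣFin-change d (f ∘ fs) (g ∘ fs) i same-rest) ⟩
    g fz + (ΣFin d (g ∘ fs) + f (fs i)) ≡⟨ sym (+-assoc (g fz) _ _) ⟩
    g fz + ΣFin d (g ∘ fs) + f (fs i)   ∎
    where
    open ≡-Reasoning
    same-rest : ∀ j → j ≢ i → f (fs j) ≡ g (fs j)
    same-rest j j≢i = same (fs j) (j≢i ∘ FinP.suc-injective)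

-- A boolean vector read as a predicate on all of ℕ (false beyond its length), and the number of
-- marks of such a predicate in a window [a, a + n): the exchange argument cuts and splices windows.
module Marks where
  open import Data.Nat
  open import Data.Nat.Properties
  open import Data.Fin using (Fin; toℕ) renaming (zero to fz; suc to fs)
  open import Data.Vec using ([]; _∷_; lookup)
  open import Data.Fin.Subset using () renaming (∣_∣ to card)
  open import Data.Product using (Σ)
  open import Relation.Binary.PropositionalEquality
  open import Relation.Nullary using (yes; no)

  member : ∀ {d} → Vec Bool d → ℕ → Bool
  member [] n = false
  member (b ∷ v) zero = b
  member (b ∷ v) (suc n) = member v n

  member-lookup : ∀ {d} (v : Vec Bool d) (i : Fin d) → lookup v i ≡ member v (toℕ i)
  member-lookup (b ∷ v) fz = refl
  member-lookup (b ∷ v) (fs i) = member-lookup v i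

  member-bound : ∀ {d} (v : Vec Bool d) n → member v n ≡ true → n < d
  member-bound (b ∷ v) zero _ = s≤s z≤n
  member-bound (b ∷ v) (suc n) e = s≤s (member-bound v n e)

  member-beyond : ∀ {d} (v : Vec Bool d) n → d ≤ n → member v n ≡ false
  member-beyond [] n _ = refl
  member-beyond (b ∷ v) (suc n) (s≤s d≤n) = member-beyond v n d≤n

  count : (ℕ → Bool) → ℕ → ℕ → ℕ
  count f a zero = 0
  count f a (suc n) = count f a n + bit (f (a + n))

  count-++ : ∀ f a m n → count f a (m + n) ≡ count f a m + count f (a + m) n
  count-++ f a m zero = trans (cong (count f a) (+-identityʳ m)) (sym (+-identityʳ _))
  count-++ f a m (suc n) = begin
    count f a (m + suc n)                                ≡⟨ cong (count f a) (+-suc m n) ⟩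
    count f a (m + n) + bit (f (a + (m + n)))            ≡⟨ cong₂ _+_ (count-++ f a m n) (cong (bit ∘ f) (sym (+-assoc a m n))) ⟩
    count f a m + count f (a + m) n + bit (f (a + m + n)) ≡⟨ +-assoc (count f a m) _ _ ⟩
    count f a m + count f (a + m) (suc n)                ∎
    where open ≡-Reasoning

  count-cong : ∀ {f g} a b n → (∀ j → j < n → f (a + j) ≡ g (b + j)) → count f a n ≡ count g b n
  count-cong a b zero h = refl
  count-cong a b (suc n) h =
    cong₂ _+_ (count-cong a b n (λ j j<n → h j (m<n⇒m<1+n j<n))) (cong bit (h n (n<1+n n)))

  count-front : ∀ f a n → count f a (suc n) ≡ bit (f a) + count f (suc a) n
  count-front f a zero = trans (cong (bit ∘ f) (+-identityʳ a)) (sym (+-identityʳ _))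
  count-front f a (suc n) = begin
    count f a (suc n) + bit (f (a + suc n))            ≡⟨ cong₂ _+_ (count-front f a n) (cong (bit ∘ f) (+-suc a n)) ⟩
    bit (f a) + count f (suc a) n + bit (f (suc a + n)) ≡⟨ +-assoc (bit (f a)) _ _ ⟩
    bit (f a) + count f (suc a) (suc n)                ∎
    where open ≡-Reasoning

  card-cons : ∀ {d} b (v : Subset d) → card (b ∷ v) ≡ bit b + card v
  card-cons true v = refl
  card-cons false v = refl

  card≡count : ∀ {d} (v : Subset d) → card v ≡ count (member v) 0 d
  card≡count [] = refl
  card≡count {suc d} (b ∷ v) = begin
    card (b ∷ v)                         ≡⟨ card-cons b v ⟩
    bit b + card v                       ≡⟨ cong (bit b +_) (card≡count v) ⟩
    bit b + count (member v) 0 d         ≡⟨ cong (bit b +_) (count-cong 0 1 d (λ _ _ → refl)) ⟩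
    bit b + count (member (b ∷ v)) 1 d   ≡⟨ sym (count-front (member (b ∷ v)) 0 d) ⟩
    count (member (b ∷ v)) 0 (suc d)     ∎
    where open ≡-Reasoning

  count-gap : ∀ f g a n → count f a n < count g a n
            → Σ ℕ λ j → j < n × g (a + j) ≡ true × f (a + j) ≡ false
  count-gap f g a (suc n) lt with count f a n <? count g a n
  ... | yes lt′ = let j , j<n , gj , fj = count-gap f g a n lt′ in j , m<n⇒m<1+n j<n , gj , fj
  ... | no ≮ = n , n<1+n n , bits-< (+-cancelˡ-< (count f a n) _ _ (<-≤-trans lt (+-monoˡ-≤ _ (≮⇒≥ ≮))))
    where
    bits-< : ∀ {x y} → bit x < bit y → y ≡ true × x ≡ false
    bits-< {false} {true} _ = refl , refl
    bits-< {true} {true} (s≤s ())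

-- The exchange property of Δ-separated sets (the combinatorial heart of the proof): if
-- |Q| ≥ |P| + 2 there is a window, bounded by two cuts, on which Q has exactly one mark more
-- than P; swapping P and Q on that window gives separated sets C and D with |C| = |P| + 1 and
-- |D| = |Q| - 1, the same total weight as P and Q, and a position in C but not in D.
module Exchange (Δ : ℕ) where
  open import Data.Bool using (if_then_else_)
  open import Data.Nat
  open import Data.Nat.Properties
  open import Data.List using (allFin)
  open import Data.Fin using (Fin; toℕ; fromℕ<) renaming (zero to fz; suc to fs)
  open import Data.Fin.Properties using (toℕ-fromℕ<; toℕ-injective)
  open import Data.Vec using ([]; _∷_; lookup)
  open import Data.Vec.Properties using ([]=⇒lookup; lookup⇒[]=)
  open import Data.Fin.Subset using (_∈_) renaming (∣_∣ to card)
  open import Data.Product using (Σ; proj₁; proj₂)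
  open import Data.Sum using (_⊎_; inj₁; inj₂; [_,_]′)
  open import Data.Empty using (⊥; ⊥-elim)
  open import Relation.Binary.PropositionalEquality
  open import Relation.Nullary using (yes; no; ¬_)
  open import Relation.Nullary.Decidable using (_×-dec_; dec-false)
  open import Relation.Binary using (tri<; tri≈; tri>)
  open Marks
  open ListSums

  Separated : (ℕ → Bool) → Set
  Separated f = ∀ u v → u < v → f u ≡ true → f v ≡ true → Δ ≤ v ∸ u

  separated-resp : ∀ {f g} → (∀ n → f n ≡ g n) → Separated f → Separated g
  separated-resp f≗g sep u v u<v gu gv =
    sep u v u<v (trans (f≗g u) gu) (trans (f≗g v) gv)

  module _ {d : ℕ} (P : Subset d) where

    private
      index : ∀ {u} (u<d : u < d) → member P u ≡ true → fromℕ< u<d ∈ P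
      index {u} u<d mark = lookup⇒[]= (fromℕ< u<d) P
        (trans (member-lookup P (fromℕ< u<d)) (trans (cong (member P) (toℕ-fromℕ< u<d)) mark))

      distance : ∀ {u v} → u < v → ∣ u - v ∣ ≡ v ∸ u
      distance {u} {v} u<v = trans (∣-∣-comm u v) (m≤n⇒∣n-m∣≡n∸m (<⇒≤ u<v))

      marked : (i : Fin d) → i ∈ P → member P (toℕ i) ≡ true
      marked i i∈P = trans (sym (member-lookup P i)) ([]=⇒lookup i∈P)

    InM⇒separated : InM Δ P → Separated (member P)
    InM⇒separated inM u v u<v pu pv =
      subst (Δ ≤_) (trans (cong₂ ∣_-_∣ (toℕ-fromℕ< u<d) (toℕ-fromℕ< v<d)) (distance u<v))
        (inM _ _ (index u<d pu) (index v<d pv)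
          (λ eq → <⇒≢ u<v (trans (sym (toℕ-fromℕ< u<d)) (trans (cong toℕ eq) (toℕ-fromℕ< v<d)))))
      where
      u<d : u < d
      u<d = member-bound P u pu
      v<d : v < d
      v<d = member-bound P v pv

    separated⇒InM : Separated (member P) → InM Δ P
    separated⇒InM sep i j i∈P j∈P i≢j with <-cmp (toℕ i) (toℕ j)
    ... | tri< i<j _ _ = subst (Δ ≤_) (sym (distance i<j)) (sep _ _ i<j (marked i i∈P) (marked j j∈P))
    ... | tri≈ _ i=j _ = ⊥-elim (i≢j (toℕ-injective i=j))
    ... | tri> _ _ j<i = subst (Δ ≤_) (trans (sym (distance j<i)) (∣-∣-comm (toℕ j) (toℕ i)))
                           (sep _ _ j<i (marked j j∈P) (marked i i∈P))

  -- t is a cut of (p, q) when a mark of either one left of t and a mark of the other at or right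
  -- of t are always Δ apart: then gluing p and q at t, in either order, preserves separation.
  Cut : (ℕ → Bool) → (ℕ → Bool) → ℕ → Set
  Cut p q t = ∀ u v → u < t → t ≤ v
            → (p u ≡ true → q v ≡ true → Δ ≤ v ∸ u) × (q u ≡ true → p v ≡ true → Δ ≤ v ∸ u)

  cut-swap : ∀ {p q t} → Cut p q t → Cut q p t
  cut-swap cut u v u<t t≤v = proj₂ (cut u v u<t t≤v) , proj₁ (cut u v u<t t≤v)

  private
    marked-and-unmarked : ∀ {b} → b ≡ true → b ≡ false → ⊥
    marked-and-unmarked refl ()

  Surplus : (ℕ → Bool) → (ℕ → Bool) → ℕ → ℕ → Set
  Surplus p q a e = Σ ℕ λ j → j < e × q (a + j) ≡ true
                  × (∀ l → j < l → l < e → q (a + l) ≡ false)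
                  × (∀ l → j ≤ l → l < e → p (a + l) ≡ false)

  fresh-surplus : ∀ p q a e → p (a + e) ≡ false → q (a + e) ≡ true → Surplus p q a (suc e)
  fresh-surplus p q a e pe qe =
    e , n<1+n e , qe , (λ l e<l l≤e → ⊥-elim (<⇒≱ e<l (s≤s⁻¹ l≤e)))
      , (λ l e≤l l≤e → subst (λ x → p (a + x) ≡ false) (≤-antisym e≤l (s≤s⁻¹ l≤e)) pe)

  extend-surplus : ∀ p q a e → Surplus p q a e → p (a + e) ≡ false → q (a + e) ≡ false
                 → Surplus p q a (suc e)
  extend-surplus p q a e (j , j<e , qj , q-quiet , p-quiet) pe qe =
    j , m<n⇒m<1+n j<e , qj , (λ l j<l → up-to-e q (q-quiet l j<l) qe) , (λ l j≤l → up-to-e p (p-quiet l j≤l) pe)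
    where
    up-to-e : ∀ f {l} → (l < e → f (a + l) ≡ false) → f (a + e) ≡ false → l < suc e → f (a + l) ≡ false
    up-to-e f before at-e l≤e =
      [ before , (λ l≡e → subst (λ x → f (a + x) ≡ false) (sym l≡e) at-e) ]′ (m<1+n⇒m<n∨m≡n l≤e)

  -- A new mark of q right after a surplus window is a cut: every mark of p or q left of it lies
  -- at or before the previous mark of q, which is Δ away from the new one.
  cut-after-surplus : ∀ p q a e → Separated q → Surplus p q a e → q (a + e) ≡ true → Cut p q (a + e)
  cut-after-surplus p q a e sep (j , j<e , qj , q-quiet , p-quiet) qe u v u<a+e a+e≤v =
    (λ pu _ → far-or (λ u≰ → marked-and-unmarked pu (proj₁ (quiet u≰))))
    , (λ qu _ → far-or (λ u≰ → marked-and-unmarked qu (proj₂ (quiet u≰))))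
    where
    quiet : ¬ (u ≤ a + j) → p u ≡ false × q u ≡ false
    quiet u≰ = subst (λ x → p x ≡ false) a+l≡u (p-quiet l (<⇒≤ j<l) l<e)
             , subst (λ x → q x ≡ false) a+l≡u (q-quiet l j<l l<e)
      where
      a+j<u : a + j < u
      a+j<u = ≰⇒> u≰
      l : ℕ
      l = u ∸ a
      a+l≡u : a + l ≡ u
      a+l≡u = m+[n∸m]≡n (≤-trans (m≤m+n a j) (<⇒≤ a+j<u))
      j<l : j < l
      j<l = +-cancelˡ-< a j l (subst (a + j <_) (sym a+l≡u) a+j<u)
      l<e : l < e
      l<e = +-cancelˡ-< a l e (subst (_< a + e) (sym a+l≡u) u<a+e)
    far-or : (¬ (u ≤ a + j) → ⊥) → Δ ≤ v ∸ u
    far-or near with u ≤? a + j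
    ... | yes u≤a+j = ≤-trans (sep _ _ (+-monoʳ-< a j<e) qj qe) (∸-mono a+e≤v u≤a+j)
    ... | no u≰ = ⊥-elim (near u≰)

  Scan : (ℕ → Bool) → (ℕ → Bool) → ℕ → ℕ → Set
  Scan p q a e = (count q a e ≤ count p a e)
               ⊎ (count q a e ≡ suc (count p a e) × Surplus p q a e)
               ⊎ (Σ ℕ λ c → 0 < c × c < e × Cut p q (a + c))

  scan : ∀ p q a → Separated q → ∀ e → Scan p q a e
  scan p q a sep zero = inj₁ z≤n
  scan p q a sep (suc e) with scan p q a sep e | p (a + e) in pe | q (a + e) in qe
  -- no surplus yet: only a q-mark without a p-mark at a + e can create one
  ... | inj₁ q≤p | false | false = inj₁ (+-mono-≤ q≤p ≤-refl)
  ... | inj₁ q≤p | true | true = inj₁ (+-mono-≤ q≤p ≤-refl)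
  ... | inj₁ q≤p | true | false = inj₁ (+-mono-≤ q≤p z≤n)
  ... | inj₁ q≤p | false | true with m≤n⇒m<n∨m≡n q≤p
  ...   | inj₁ q<p = inj₁ (subst₂ _≤_ (+-comm 1 _) (sym (+-identityʳ _)) q<p)
  ...   | inj₂ q≡p = inj₂ (inj₁ (trans (+-comm _ 1) (cong suc (trans q≡p (sym (+-identityʳ _))))
                                , fresh-surplus p q a e pe qe))
  -- a surplus of one: kept by an unmarked position, cancelled by a lone p-mark, and turned
  -- into a cut at a + e by a new q-mark
  scan p q a sep (suc e) | inj₂ (inj₁ (q≡1+p , surplus)) | false | false =
    inj₂ (inj₁ (trans (+-identityʳ _) (trans q≡1+p (cong suc (sym (+-identityʳ _))))
               , extend-surplus p q a e surplus pe qe))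
  scan p q a sep (suc e) | inj₂ (inj₁ (q≡1+p , surplus)) | true | false =
    inj₁ (subst₂ _≤_ (sym (trans (+-identityʳ _) q≡1+p)) (+-comm 1 _) ≤-refl)
  scan p q a sep (suc e) | inj₂ (inj₁ (_ , surplus@(j , j<e , _))) | _ | true =
    inj₂ (inj₂ (e , ≤-trans (s≤s z≤n) j<e , n<1+n e , cut-after-surplus p q a e sep surplus qe))
  scan p q a sep (suc e) | inj₂ (inj₂ (c , 0<c , c<e , cut)) | _ | _ =
    inj₂ (inj₂ (c , 0<c , m<n⇒m<1+n c<e , cut))

  record Block (p q : ℕ → Bool) (a n : ℕ) : Set where
    constructor block
    field
      t m : ℕ
      a≤t : a ≤ t
      t+m≤a+n : t + m ≤ a + n
      left-cut : Cut p q t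
      right-cut : Cut p q (t + m)
      one-more : count q t m ≡ suc (count p t m)

  -- A window bounded by cuts on which q has a surplus contains a block: split it at an inner cut
  -- found by the scan and recurse into a half that still has a surplus (induction on the length,
  -- bounded by fuel).
  find-block : ∀ p q → Separated q → ∀ fuel n a → n ≤ fuel → Cut p q a → Cut p q (a + n)
             → suc (count p a n) ≤ count q a n → Block p q a n
  find-block p q sep zero zero a _ _ _ ()
  find-block p q sep (suc fuel) n a n≤fuel cutₗ cutᵣ surplus with scan p q a sep n
  ... | inj₁ q≤p = ⊥-elim (<⇒≱ surplus q≤p)
  ... | inj₂ (inj₁ (exact , _)) = block a n ≤-refl ≤-refl cutₗ cutᵣ exact
  ... | inj₂ (inj₂ (c , 0<c , c<n , cutₘ)) with suc (count p a c) ≤? count q a c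
  ...   | yes left =
            let block t m a≤t t+m≤ cutₜ cutₜₘ exact = find-block p q sep fuel c a c≤fuel cutₗ cutₘ left
            in block t m a≤t (≤-trans t+m≤ (+-monoʳ-≤ a (<⇒≤ c<n))) cutₜ cutₜₘ exact
    where
    c≤fuel : c ≤ fuel
    c≤fuel = s≤s⁻¹ (≤-trans c<n n≤fuel)
  ...   | no ¬left =
            let block t m a+c≤t t+m≤ cutₜ cutₜₘ exact =
                  find-block p q sep fuel r (a + c) r≤fuel cutₘ (subst (Cut p q) (sym a+c+r≡a+n) cutᵣ) right
            in block t m (≤-trans (m≤m+n a c) a+c≤t) (subst (t + m ≤_) a+c+r≡a+n t+m≤) cutₜ cutₜₘ exact
    where
    r : ℕ
    r = n ∸ c
    c+r≡n : c + r ≡ n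
    c+r≡n = m+[n∸m]≡n (<⇒≤ c<n)
    a+c+r≡a+n : a + c + r ≡ a + n
    a+c+r≡a+n = trans (+-assoc a c r) (cong (a +_) c+r≡n)
    r≤fuel : r ≤ fuel
    r≤fuel = s≤s⁻¹ (≤-trans (subst (r <_) c+r≡n (m<n+m r 0<c)) n≤fuel)
    halves : ∀ f → count f a n ≡ count f a c + count f (a + c) r
    halves f = subst (λ z → count f a z ≡ count f a c + count f (a + c) r) c+r≡n (count-++ f a c r)
    -- the left half has no surplus, so the right half carries it
    right : suc (count p (a + c) r) ≤ count q (a + c) r
    right = +-cancelˡ-≤ (count p a c) _ _ (≤-trans (≤-reflexive (+-suc (count p a c) _))
              (≤-trans (subst₂ (λ x y → suc x ≤ y) (halves p) (halves q) surplus)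
                (+-monoˡ-≤ _ (s≤s⁻¹ (≰⇒> ¬left)))))

  window? : ∀ t₁ t₂ n → Dec (t₁ ≤ n × n < t₂)
  window? t₁ t₂ n = (t₁ ≤? n) ×-dec (n <? t₂)

  glue : ℕ → ℕ → (ℕ → Bool) → (ℕ → Bool) → ℕ → Bool
  glue t₁ t₂ p q n = if does (window? t₁ t₂ n) then q n else p n

  glue-inside : ∀ {t₁ t₂ n} p q → t₁ ≤ n → n < t₂ → glue t₁ t₂ p q n ≡ q n
  glue-inside {t₁} {t₂} {n} p q t₁≤n n<t₂ =
    cong (λ b → if b then q n else p n) (dec-true (window? t₁ t₂ n) (t₁≤n , n<t₂))

  glue-outside : ∀ {t₁ t₂ n} p q → ¬ (t₁ ≤ n × n < t₂) → glue t₁ t₂ p q n ≡ p n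
  glue-outside {t₁} {t₂} {n} p q n∉ = cong (λ b → if b then q n else p n) (dec-false (window? t₁ t₂ n) n∉)

  marked-inside : ∀ {t₁ t₂ n} p q → t₁ ≤ n → n < t₂ → glue t₁ t₂ p q n ≡ true → q n ≡ true
  marked-inside p q t₁≤n n<t₂ = trans (sym (glue-inside p q t₁≤n n<t₂))

  marked-outside : ∀ {t₁ t₂ n} p q → ¬ (t₁ ≤ n × n < t₂) → glue t₁ t₂ p q n ≡ true → p n ≡ true
  marked-outside p q n∉ = trans (sym (glue-outside p q n∉))

  glue-separated : ∀ {p q t₁ t₂} → Separated p → Separated q → Cut p q t₁ → Cut p q t₂
                 → Separated (glue t₁ t₂ p q)
  glue-separated {p} {q} {t₁} {t₂} sep-p sep-q cut₁ cut₂ u v u<v gu gv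
    with window? t₁ t₂ u | window? t₁ t₂ v
  ... | yes (t₁≤u , u<t₂) | yes (t₁≤v , v<t₂) =
    sep-q u v u<v (marked-inside p q t₁≤u u<t₂ gu) (marked-inside p q t₁≤v v<t₂ gv)
  ... | no u∉ | no v∉ =
    sep-p u v u<v (marked-outside p q u∉ gu) (marked-outside p q v∉ gv)
  ... | yes (t₁≤u , u<t₂) | no v∉ =
    proj₂ (cut₂ u v u<t₂ (≮⇒≥ (λ v<t₂ → v∉ (≤-trans t₁≤u (<⇒≤ u<v) , v<t₂))))
      (marked-inside p q t₁≤u u<t₂ gu) (marked-outside p q v∉ gv)
  ... | no u∉ | yes (t₁≤v , v<t₂) =
    proj₁ (cut₁ u v (≰⇒> (λ t₁≤u → u∉ (t₁≤u , <-trans u<v v<t₂))) t₁≤v)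
      (marked-outside p q u∉ gu) (marked-inside p q t₁≤v v<t₂ gv)

  count-windows : ∀ f t m r → count f 0 (t + m + r) ≡ count f 0 t + count f t m + count f (t + m) r
  count-windows f t m r = trans (count-++ f 0 (t + m) r) (cong (_+ count f (t + m) r) (count-++ f 0 t m))

  count-glue : ∀ p q t m r
             → count (glue t (t + m) p q) 0 (t + m + r) ≡ count p 0 t + count q t m + count p (t + m) r
  count-glue p q t m r = trans (count-windows (glue t (t + m) p q) t m r)
    (cong₂ _+_ (cong₂ _+_ (count-cong 0 0 t (λ j j<t → glue-outside {t} {t + m} p q (λ (t≤j , _) → <⇒≱ j<t t≤j)))
                          (count-cong t t m (λ j j<m → glue-inside {t} {t + m} p q (m≤m+n t j) (+-monoʳ-< t j<m))))
               (count-cong (t + m) (t + m) r (λ j _ → glue-outside {t} {t + m} p q (λ (_ , lt) → <⇒≱ lt (m≤m+n (t + m) j)))))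

  splice : ∀ {d} → (ℕ → Bool) → Subset d → Subset d → Subset d
  splice s [] [] = []
  splice s (x ∷ P) (y ∷ Q) = (if s 0 then y else x) ∷ splice (s ∘ suc) P Q

  member-splice : ∀ {d} s (P Q : Subset d) n → member (splice s P Q) n ≡ (if s n then member Q n else member P n)
  member-splice s [] [] n with s n
  ... | true = refl
  ... | false = refl
  member-splice s (x ∷ P) (y ∷ Q) zero = refl
  member-splice s (x ∷ P) (y ∷ Q) (suc n) = member-splice (s ∘ suc) P Q n

  lookup-splice : ∀ {d} s (P Q : Subset d) i → lookup (splice s P Q) i ≡ (if s (toℕ i) then lookup Q i else lookup P i)
  lookup-splice s (x ∷ P) (y ∷ Q) fz = refl
  lookup-splice s (x ∷ P) (y ∷ Q) (fs i) = lookup-splice (s ∘ suc) P Q i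

  -- Splicing both ways redistributes the elements of P and Q, so total weight is preserved.
  splice-weights : ∀ {d} s (P Q : Subset d) x
                 → sumOver (splice s P Q) x + sumOver (splice s Q P) x ≡ sumOver P x + sumOver Q x
  splice-weights {d} s P Q x = begin
    sumOver (splice s P Q) x + sumOver (splice s Q P) x
      ≡⟨ cong₂ _+_ (sum-map _ (allFin d)) (sum-map _ (allFin d)) ⟩
    sumBy (term (splice s P Q)) (allFin d) + sumBy (term (splice s Q P)) (allFin d)
      ≡⟨ sym (sumBy-+ _ _ (allFin d)) ⟩
    sumBy (λ i → term (splice s P Q) i + term (splice s Q P) i) (allFin d)
      ≡⟨ sumBy-cong (allFin d) pointwise ⟩
    sumBy (λ i → term P i + term Q i) (allFin d)
      ≡⟨ sumBy-+ _ _ (allFin d) ⟩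
    sumBy (term P) (allFin d) + sumBy (term Q) (allFin d)
      ≡⟨ sym (cong₂ _+_ (sum-map _ (allFin d)) (sum-map _ (allFin d))) ⟩
    sumOver P x + sumOver Q x
      ∎
    where
    open ≡-Reasoning
    term : Subset d → Fin d → ℕ
    term S i = if lookup S i then lookup x i else 0
    pointwise : ∀ i → term (splice s P Q) i + term (splice s Q P) i ≡ term P i + term Q i
    pointwise i rewrite lookup-splice s P Q i | lookup-splice s Q P i with s (toℕ i)
    ... | true = +-comm (term Q i) (term P i)
    ... | false = refl

  module WindowSwap {d : ℕ} (t m : ℕ) (t+m≤d : t + m ≤ d) where

    inside : ℕ → Bool
    inside n = does (window? t (t + m) n)

    swap : Subset d → Subset d → Subset d
    swap = splice inside

    rest : ℕ
    rest = d ∸ (t + m)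

    private
      t+m+rest≡d : t + m + rest ≡ d
      t+m+rest≡d = m+[n∸m]≡n t+m≤d

    swap-separated : ∀ (A B : Subset d) → Separated (member A) → Separated (member B)
                   → Cut (member A) (member B) t → Cut (member A) (member B) (t + m) → InM Δ (swap A B)
    swap-separated A B sep-A sep-B cutₜ cutₜ₊ₘ =
      separated⇒InM (swap A B) (separated-resp (sym ∘ member-splice inside A B) (glue-separated sep-A sep-B cutₜ cutₜ₊ₘ))

    card-windows : ∀ (A : Subset d) → card A ≡ count (member A) 0 t + count (member A) t m + count (member A) (t + m) rest
    card-windows A = trans (card≡count A)
      (subst (λ e → count (member A) 0 e ≡ count (member A) 0 t + count (member A) t m + count (member A) (t + m) rest)
        t+m+rest≡d (count-windows (member A) t m rest))

    card-swap : ∀ (A B : Subset d) → card (swap A B) ≡ count (member A) 0 t + count (member B) t m + count (member A) (t + m) rest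
    card-swap A B = trans (card≡count (swap A B)) (trans (count-cong 0 0 d (λ j _ → member-splice inside A B j))
      (subst (λ e → count (glue t (t + m) (member A) (member B)) 0 e
                  ≡ count (member A) 0 t + count (member B) t m + count (member A) (t + m) rest)
        t+m+rest≡d (count-glue (member A) (member B) t m rest)))

    swap-inside : ∀ (A B : Subset d) {u} (u<d : u < d) → t ≤ u → u < t + m → lookup (swap A B) (fromℕ< u<d) ≡ member B u
    swap-inside A B {u} u<d t≤u u<t+m = begin
      lookup (swap A B) (fromℕ< u<d)        ≡⟨ member-lookup (swap A B) (fromℕ< u<d) ⟩
      member (swap A B) (toℕ (fromℕ< u<d))  ≡⟨ cong (member (swap A B)) (toℕ-fromℕ< u<d) ⟩
      member (swap A B) u                   ≡⟨ member-splice inside A B u ⟩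
      glue t (t + m) (member A) (member B) u ≡⟨ glue-inside {t} {t + m} (member A) (member B) t≤u u<t+m ⟩
      member B u                            ∎
      where open ≡-Reasoning

  record Exchanged {d : ℕ} (P Q : Subset d) : Set where
    field
      C D : Subset d
      C-sep : InM Δ C
      D-sep : InM Δ D
      C-card : card C ≡ suc (card P)
      D-card : suc (card D) ≡ card Q
      weights : ∀ x → sumOver C x + sumOver D x ≡ sumOver P x + sumOver Q x
      witness : Σ (Fin d) λ i → lookup C i ≡ true × lookup D i ≡ false

  -- The exchange lemma: the whole range [0, d) is bounded by (trivial) cuts and Q has a surplus
  -- on it, so it contains a block; swapping P and Q on the block gives C and D.
  exchange : ∀ {d} (P Q : Subset d) → InM Δ P → InM Δ Q → card P + 2 ≤ card Q → Exchanged P Q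
  exchange {d} P Q P-sep Q-sep size = record
    { C = swap P Q
    ; D = swap Q P
    ; C-sep = swap-separated P Q sep-p sep-q cutₜ cutₜ₊ₘ
    ; D-sep = swap-separated Q P sep-q sep-p (cut-swap cutₜ) (cut-swap cutₜ₊ₘ)
    ; C-card = C-card
    ; D-card = D-card
    ; weights = splice-weights inside P Q
    ; witness = witness
    }
    where
    open ≡-Reasoning
    p q : ℕ → Bool
    p = member P
    q = member Q
    sep-p : Separated p
    sep-p = InM⇒separated P P-sep
    sep-q : Separated q
    sep-q = InM⇒separated Q Q-sep
    start : Cut p q 0
    start u v ()
    end : Cut p q d
    end u v _ d≤v = (λ _ qv → ⊥-elim (marked-and-unmarked qv (member-beyond Q v d≤v)))
                  , (λ _ pv → ⊥-elim (marked-and-unmarked pv (member-beyond P v d≤v)))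
    surplus : suc (count p 0 d) ≤ count q 0 d
    surplus = subst₂ (λ x y → suc x ≤ y) (card≡count P) (card≡count Q)
                (≤-trans (≤-trans (n≤1+n _) (≤-reflexive (+-comm 2 (card P)))) size)
    open Block (find-block p q sep-q d d 0 ≤-refl start end surplus)
      renaming (t+m≤a+n to t+m≤d; left-cut to cutₜ; right-cut to cutₜ₊ₘ; one-more to exact)
    open WindowSwap t m t+m≤d
    C-card : card (swap P Q) ≡ suc (card P)
    C-card = begin
      card (swap P Q)                                         ≡⟨ card-swap P Q ⟩
      count p 0 t + count q t m + count p (t + m) rest        ≡⟨ cong (λ z → count p 0 t + z + count p (t + m) rest) exact ⟩
      count p 0 t + suc (count p t m) + count p (t + m) rest  ≡⟨ cong (_+ count p (t + m) rest) (+-suc (count p 0 t) _) ⟩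
      suc (count p 0 t + count p t m + count p (t + m) rest)  ≡⟨ cong suc (sym (card-windows P)) ⟩
      suc (card P)                                            ∎
    D-card : suc (card (swap Q P)) ≡ card Q
    D-card = begin
      suc (card (swap Q P))                                   ≡⟨ cong suc (card-swap Q P) ⟩
      suc (count q 0 t + count p t m + count q (t + m) rest)  ≡⟨ cong (_+ count q (t + m) rest) (sym (+-suc (count q 0 t) _)) ⟩
      count q 0 t + suc (count p t m) + count q (t + m) rest  ≡⟨ cong (λ z → count q 0 t + z + count q (t + m) rest) (sym exact) ⟩
      count q 0 t + count q t m + count q (t + m) rest        ≡⟨ sym (card-windows Q) ⟩
      card Q                                                  ∎
    witness : Σ (Fin d) λ i → lookup (swap P Q) i ≡ true × lookup (swap Q P) i ≡ false
    witness with count-gap p q t m (subst (count p t m <_) (sym exact) (n<1+n _))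
    ... | j , j<m , qu , pu = fromℕ< u<d , trans (swap-inside P Q u<d t≤u u<t+m) qu
                                         , trans (swap-inside Q P u<d t≤u u<t+m) pu
      where
      u<d : t + j < d
      u<d = member-bound Q (t + j) qu
      t≤u : t ≤ t + j
      t≤u = m≤m+n t j
      u<t+m : t + j < t + m
      u<t+m = +-monoʳ-< t j<m

-- Linear inequalities between integers. Each conclusion is certified by writing its slack as a sum
-- of slacks of the hypotheses; the identity is checked by the ring solver.
module LinearBounds where
  open import Data.Nat using (z≤n; s≤s)
  open import Data.Integer hiding (suc; _/_)
  open import Data.Integer.Properties
  open import Data.Integer.Tactic.RingSolver using (solve-∀)
  open import Relation.Binary.PropositionalEquality

  ≤-from : ∀ {a b} x y → b - a ≡ x + y → 0ℤ ≤ x → 0ℤ ≤ y → a ≤ b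
  ≤-from x y eq 0≤x 0≤y = 0≤i-j⇒j≤i (subst (0ℤ ≤_) (sym eq) (+-mono-≤ 0≤x 0≤y))

  <-from : ∀ {a b} x y → b - (1ℤ + a) ≡ x + y → 0ℤ ≤ x → 0ℤ ≤ y → a < b
  <-from x y eq 0≤x 0≤y = suc[i]≤j⇒i<j (≤-from x y eq 0≤x 0≤y)

  slack-≤ : ∀ {a b} → a ≤ b → 0ℤ ≤ b - a
  slack-≤ = i≤j⇒0≤j-i

  slack-< : ∀ {a b} → a < b → 0ℤ ≤ b - (1ℤ + a)
  slack-< a<b = i≤j⇒0≤j-i (i<j⇒suc[i]≤j a<b)

  positive-difference : ∀ {a b} → 0ℤ < b - a → a < b
  positive-difference {a} {b} 0<b-a = <-from _ 0ℤ (identity a b) (slack-< 0<b-a) (+≤+ z≤n)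
    where
    identity : ∀ a b → b - (1ℤ + a) ≡ (b - a - (1ℤ + 0ℤ)) + 0ℤ
    identity = solve-∀

  cancel-positive : ∀ (m : ℕ) Z → 0ℤ < + suc m * Z → 0ℤ < Z
  cancel-positive m Z 0<mZ = *-cancelˡ-<-nonNeg (+ suc m) (subst (_< + suc m * Z) (sym (*-zeroʳ (+ suc m))) 0<mZ)

  -- Comparing S with a k-set of weight F at the multiplier μ - 1/m (m ≥ 2), when |S| = k + (r + 1).
  lowered-above : ∀ F w μ (e r : ℕ) → let m = + suc (suc e) in
                  F * m + (μ * m - 1ℤ) * 0ℤ ≤ w * m + (μ * m - 1ℤ) * (- + suc r)
                → F + (μ - 1ℤ) * + suc r < w
  lowered-above F w μ e r h = positive-difference (cancel-positive (suc e) _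
    (subst (0ℤ <_) (identity F w μ (+ suc e) (+ suc r)) (+-mono-≤-< (slack-≤ h) (+<+ (s≤s z≤n)))))
    where
    identity : ∀ F w μ M R → ((w * (1ℤ + M) + (μ * (1ℤ + M) - 1ℤ) * (- R)) - (F * (1ℤ + M) + (μ * (1ℤ + M) - 1ℤ) * 0ℤ))
                             + M * R ≡ (1ℤ + M) * (w - (F + (μ - 1ℤ) * R))
    identity = solve-∀

  -- Comparing S with a k-set of weight F at the multiplier μ - 1/m, when |S| + (r + 1) = k.
  lowered-below : ∀ F w μ (e r : ℕ) → let m = + suc e in
                  F * m + (μ * m - 1ℤ) * 0ℤ ≤ w * m + (μ * m - 1ℤ) * + suc r
                → F < w + μ * + suc r
  lowered-below F w μ e r h = positive-difference (cancel-positive e _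
    (subst (0ℤ <_) (identity F w μ (+ suc e) (+ suc r)) (+-mono-≤-< (slack-≤ h) (+<+ (s≤s z≤n)))))
    where
    identity : ∀ F w μ m R → ((w * m + (μ * m - 1ℤ) * R) - (F * m + (μ * m - 1ℤ) * 0ℤ)) + R ≡ m * ((w + μ * R) - F)
    identity = solve-∀

  isolate : ∀ a b c → a + b ≡ c → b ≡ c - a
  isolate a b c eq = trans (identity a b) (cong (_- a) eq)
    where
    identity : ∀ a b → b ≡ (a + b) - a
    identity = solve-∀

  -- One exchange step moving a set of size k + (N + 2) towards size k + 1 (resp. of size
  -- k - (N + 2) towards k - 1) against a k-set of weight F, where C is the part not kept.
  exchange-above : ∀ F β wT wC wD N → wC + wD ≡ F + wT → wC ≤ F + β → F + β * (1ℤ + N) < wT → F + β * N < wD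
  exchange-above F β wT wC wD N sum wC≤ lt = <-from _ _
    (trans (cong (λ z → z - (1ℤ + (F + β * N))) (isolate wC wD (F + wT) sum)) (identity F β wT wC N))
    (slack-< lt) (slack-≤ wC≤)
    where
    identity : ∀ F β wT wC N → ((F + wT) - wC) - (1ℤ + (F + β * N)) ≡ (wT - (1ℤ + (F + β * (1ℤ + N)))) + ((F + β) - wC)
    identity = solve-∀

  exchange-below : ∀ F β wT wC wD N → wC + wD ≡ wT + F → wD + β ≤ F → F < wT + β * (1ℤ + N) → F < wC + β * N
  exchange-below F β wT wC wD N sum wD≤ lt = <-from _ _
    (trans (cong (λ z → z + β * N - (1ℤ + F)) (isolate wD wC (wT + F) (trans (+-comm wD wC) sum))) (identity F β wT wD N))
    (slack-< lt) (slack-≤ wD≤)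
    where
    identity : ∀ F β wT wD N → (((wT + F) - wD) + β * N) - (1ℤ + F) ≡ (wT + β * (1ℤ + N) - (1ℤ + F)) + (F - (wD + β))
    identity = solve-∀

  pair-bound : ∀ F μ wA wB → F + (μ - 1ℤ) < wA → F < wB + (μ + 1ℤ) → F + F ≤ wA + wB
  pair-bound F μ wA wB A-big B-big = ≤-from _ _ (identity F μ wA wB) (slack-< A-big) (slack-< B-big)
    where
    identity : ∀ F μ wA wB → (wA + wB) - (F + F) ≡ (wA - (1ℤ + (F + (μ - 1ℤ)))) + ((wB + (μ + 1ℤ)) - (1ℤ + F))
    identity = solve-∀

  -- If raising (lowering) the multiplier by one increases (does not decrease) the Lagrangian value
  -- w + μ g of a set beyond (to) a bound X on its value at μ, the deficit g is positive (non-positive).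
  deficit-positive : ∀ w g μ X → w + μ * g ≤ X → X < w + (μ + 1ℤ) * g → 0ℤ < g
  deficit-positive w g μ X at-μ above = <-from _ _ (identity w g μ X) (slack-< above) (slack-≤ at-μ)
    where
    identity : ∀ w g μ X → g - (1ℤ + 0ℤ) ≡ ((w + (μ + 1ℤ) * g) - (1ℤ + X)) + (X - (w + μ * g))
    identity = solve-∀

  deficit-nonpositive : ∀ w g μ X → w + μ * g ≤ X → X ≤ w + (μ - 1ℤ) * g → g ≤ 0ℤ
  deficit-nonpositive w g μ X at-μ below = ≤-from _ _ (identity w g μ X) (slack-≤ below) (slack-≤ at-μ)
    where
    identity : ∀ w g μ X → 0ℤ - g ≡ ((w + (μ - 1ℤ) * g) - X) + (X - (w + μ * g))
    identity = solve-∀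

  move-term : ∀ F w β N → F < w + β * (- N) → F + β * N < w
  move-term F w β N lt = <-from _ 0ℤ (identity F w β N) (slack-< lt) (+≤+ z≤n)
    where
    identity : ∀ F w β N → w - (1ℤ + (F + β * N)) ≡ ((w + β * (- N)) - (1ℤ + F)) + 0ℤ
    identity = solve-∀

-- Comparing values a + λ b of the Lagrangian objective (a, b integers) for multipliers λ = n / (e + 1)
-- with a common denominator amounts to comparing the integers a (e + 1) + n b.
module FractionFree where
  open import Data.Integer using (+_; 1ℤ)
  open import Data.Rational using (toℚᵘ)
  open import Data.Rational.Unnormalised as U using (ℚᵘ; mkℚᵘ; *≡*; *≤*; *<*)
  import Data.Rational.Unnormalised.Properties as UP
  open import Relation.Binary.PropositionalEquality

  value : ℤ → ℤ → ℚᵘ → ℚᵘ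
  value a b L = mkℚᵘ a 0 U.+ L U.* mkℚᵘ b 0

  value-≃ : (a b : ℤ) (λ′ : ℚ) (L : ℚᵘ) → toℚᵘ λ′ U.≃ L → toℚᵘ ((a / 1) ℚ.+ λ′ ℚ.* (b / 1)) U.≃ value a b L
  value-≃ a b λ′ L λ′≃L =
    UP.≃-trans (ℚP.toℚᵘ-homo-+ (a / 1) (λ′ ℚ.* (b / 1)))
      (UP.+-cong (ℚP.toℚᵘ-fromℚᵘ (mkℚᵘ a 0))
        (UP.≃-trans (ℚP.toℚᵘ-homo-* λ′ (b / 1)) (UP.*-cong λ′≃L (ℚP.toℚᵘ-fromℚᵘ (mkℚᵘ b 0)))))

  private
    numerator : (a n b : ℤ) (e : ℕ) → a ℤ.* + suc (e ℕ.* 1) ℤ.+ (n ℤ.* b) ℤ.* + 1 ≡ a ℤ.* + suc e ℤ.+ n ℤ.* b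
    numerator a n b e rewrite ℕP.*-identityʳ e | ℤP.*-identityʳ (n ℤ.* b) = refl

    scale : ℕ → ℤ
    scale e = + suc (e ℕ.* 1 ℕ.+ 0)

  value-≤ : (a b a′ b′ n n′ : ℤ) (e : ℕ) → value a b (mkℚᵘ n e) U.≤ value a′ b′ (mkℚᵘ n′ e)
          → a ℤ.* + suc e ℤ.+ n ℤ.* b ℤ.≤ a′ ℤ.* + suc e ℤ.+ n′ ℤ.* b′
  value-≤ a b a′ b′ n n′ e (*≤* h) = ℤP.*-cancelʳ-≤-pos _ _ (scale e)
    (subst₂ (λ x y → x ℤ.* scale e ℤ.≤ y ℤ.* scale e) (numerator a n b e) (numerator a′ n′ b′ e) h)

  value-< : (a b a′ b′ n n′ : ℤ) (e : ℕ) → value a b (mkℚᵘ n e) U.< value a′ b′ (mkℚᵘ n′ e)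
          → a ℤ.* + suc e ℤ.+ n ℤ.* b ℤ.< a′ ℤ.* + suc e ℤ.+ n′ ℤ.* b′
  value-< a b a′ b′ n n′ e (*<* h) = ℤP.*-cancelʳ-<-nonNeg (scale e)
    (subst₂ (λ x y → x ℤ.* scale e ℤ.< y ℤ.* scale e) (numerator a n b e) (numerator a′ n′ b′ e) h)

  integer-≃ : (μ : ℤ) → toℚᵘ (μ / 1) U.≃ mkℚᵘ μ 0
  integer-≃ μ = ℚP.toℚᵘ-fromℚᵘ (mkℚᵘ μ 0)

  lowered-≃ : (μ : ℤ) (d : ℕ) → toℚᵘ ((μ / 1) ℚ.- (+ 1 / suc d)) U.≃ mkℚᵘ (μ ℤ.* + suc d ℤ.- 1ℤ) d
  lowered-≃ μ d = UP.≃-trans (ℚP.toℚᵘ-homo-+ (μ / 1) (ℚ.- (+ 1 / suc d)))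
    (UP.≃-trans (UP.+-cong (integer-≃ μ) (UP.≃-trans (ℚP.toℚᵘ-homo‿- (+ 1 / suc d)) (UP.-‿cong (ℚP.toℚᵘ-fromℚᵘ (mkℚᵘ (+ 1) d)))))
      (*≡* (trans (cong (ℤ._* + suc d) (cong (λ z → μ ℤ.* + suc d ℤ.+ z) (ℤP.*-identityʳ (ℤ.- + 1))))
                  (cong ((μ ℤ.* + suc d ℤ.- + 1) ℤ.*_) (cong (λ z → + suc z) (sym (ℕP.+-identityʳ d)))))))

module Lagrangian (k : ℕ) {d : ℕ} (c : Vec ℕ d) where
  open import Data.Integer using (+_; 1ℤ; 0ℤ)
  open import Data.Integer.Tactic.RingSolver using (solve-∀)
  open import Data.Rational using (toℚᵘ)
  open import Data.Rational.Unnormalised as U using (mkℚᵘ)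
  import Data.Rational.Unnormalised.Properties as UP
  open import Data.Fin.Subset using () renaming (∣_∣ to card)
  open import Relation.Binary.PropositionalEquality
  open FractionFree

  weight : Subset d → ℤ
  weight S = + sumOver S c

  deficit : Subset d → ℤ
  deficit S = + k ℤ.- + card S

  L : ℤ → Subset d → ℤ
  L μ S = weight S ℤ.+ μ ℤ.* deficit S

  lowered : ℤ → ℚ
  lowered μ = (μ / 1) ℚ.- (+ 1 / suc d)

  private
    compare-≤ : ∀ λ₁ λ₂ n₁ n₂ e S T → toℚᵘ λ₁ U.≃ mkℚᵘ n₁ e → toℚᵘ λ₂ U.≃ mkℚᵘ n₂ e
              → lagr k λ₁ c S ℚ.≤ lagr k λ₂ c T
              → weight S ℤ.* + suc e ℤ.+ n₁ ℤ.* deficit S ℤ.≤ weight T ℤ.* + suc e ℤ.+ n₂ ℤ.* deficit T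
    compare-≤ λ₁ λ₂ n₁ n₂ e S T ≃₁ ≃₂ le = value-≤ (weight S) (deficit S) (weight T) (deficit T) n₁ n₂ e
      (UP.≤-respʳ-≃ (value-≃ (weight T) (deficit T) λ₂ _ ≃₂)
        (UP.≤-respˡ-≃ (value-≃ (weight S) (deficit S) λ₁ _ ≃₁) (ℚP.toℚᵘ-mono-≤ le)))

    compare-< : ∀ λ₁ λ₂ n₁ n₂ e S T → toℚᵘ λ₁ U.≃ mkℚᵘ n₁ e → toℚᵘ λ₂ U.≃ mkℚᵘ n₂ e
              → lagr k λ₁ c S ℚ.< lagr k λ₂ c T
              → weight S ℤ.* + suc e ℤ.+ n₁ ℤ.* deficit S ℤ.< weight T ℤ.* + suc e ℤ.+ n₂ ℤ.* deficit T
    compare-< λ₁ λ₂ n₁ n₂ e S T ≃₁ ≃₂ lt = value-< (weight S) (deficit S) (weight T) (deficit T) n₁ n₂ e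
      (UP.<-respʳ-≃ (value-≃ (weight T) (deficit T) λ₂ _ ≃₂)
        (UP.<-respˡ-≃ (value-≃ (weight S) (deficit S) λ₁ _ ≃₁) (ℚP.toℚᵘ-mono-< lt)))

    unscaled : ∀ μ S → weight S ℤ.* + 1 ℤ.+ μ ℤ.* deficit S ≡ L μ S
    unscaled μ S = cong (ℤ._+ μ ℤ.* deficit S) (ℤP.*-identityʳ (weight S))

  L-≤ : ∀ μ ν S T → lagr k (μ / 1) c S ℚ.≤ lagr k (ν / 1) c T → L μ S ℤ.≤ L ν T
  L-≤ μ ν S T le = subst₂ ℤ._≤_ (unscaled μ S) (unscaled ν T)
    (compare-≤ (μ / 1) (ν / 1) μ ν 0 S T (integer-≃ μ) (integer-≃ ν) le)

  L-< : ∀ μ ν S T → lagr k (μ / 1) c S ℚ.< lagr k (ν / 1) c T → L μ S ℤ.< L ν T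
  L-< μ ν S T lt = subst₂ ℤ._<_ (unscaled μ S) (unscaled ν T)
    (compare-< (μ / 1) (ν / 1) μ ν 0 S T (integer-≃ μ) (integer-≃ ν) lt)

  lowered-≤ : ∀ μ S T → lagr k (lowered μ) c S ℚ.≤ lagr k (lowered μ) c T
            → weight S ℤ.* + suc d ℤ.+ (μ ℤ.* + suc d ℤ.- 1ℤ) ℤ.* deficit S
              ℤ.≤ weight T ℤ.* + suc d ℤ.+ (μ ℤ.* + suc d ℤ.- 1ℤ) ℤ.* deficit T
  lowered-≤ μ S T = compare-≤ (lowered μ) (lowered μ) _ _ d S T (lowered-≃ μ d) (lowered-≃ μ d)

  deficit-exact : ∀ S → card S ≡ k → deficit S ≡ 0ℤ
  deficit-exact S size = trans (cong (λ x → + k ℤ.- + x) size) (ℤP.+-inverseʳ (+ k))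

  deficit-excess : ∀ S {n} → card S ≡ k ℕ.+ n → deficit S ≡ ℤ.- + n
  deficit-excess S {n} size = trans (cong (λ x → + k ℤ.- + x) size) (identity (+ k) (+ n))
    where
    identity : ∀ K N → K ℤ.- (K ℤ.+ N) ≡ ℤ.- N
    identity = solve-∀

  deficit-shortfall : ∀ S {n} → card S ℕ.+ n ≡ k → deficit S ≡ + n
  deficit-shortfall S {n} size = trans (cong (λ x → + x ℤ.- + card S) (sym size)) (identity (+ card S) (+ n))
    where
    identity : ∀ K N → (K ℤ.+ N) ℤ.- K ≡ N
    identity = solve-∀

  short-of-k : ∀ S → 0ℤ ℤ.< deficit S → card S ℕ.< k
  short-of-k S 0<deficit = ℤP.drop‿+<+ (LinearBounds.positive-difference 0<deficit)

  at-least-k : ∀ S → deficit S ℤ.≤ 0ℤ → k ℕ.≤ card S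
  at-least-k S deficit≤0 = ℤP.drop‿+≤+ (ℤP.i-j≤0⇒i≤j deficit≤0)

squeeze : ∀ x y f → x ℕ.≤ f → y ℕ.≤ f → f ℕ.+ f ℕ.≤ x ℕ.+ y → x ≡ f × y ≡ f
squeeze x y f x≤f y≤f 2f≤ =
  ℕP.≤-antisym x≤f (ℕP.+-cancelʳ-≤ f f x (ℕP.≤-trans 2f≤ (ℕP.+-monoʳ-≤ x y≤f))) ,
  ℕP.≤-antisym y≤f (ℕP.+-cancelˡ-≤ f f y (ℕP.≤-trans 2f≤ (ℕP.+-monoˡ-≤ y x≤f)))

module Optimality (Δ k : ℕ) {d : ℕ} where
  open import Data.Vec using (lookup)
  open import Data.Fin using (Fin)
  open import Data.Fin.Subset using () renaming (∣_∣ to card)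
  open import Data.Product using (Σ)

  Feasible : Subset d → Set
  Feasible S = InM Δ S × card S ≡ k

  Optimal : Vec ℕ d → Subset d → Set
  Optimal x S = Feasible S × (∀ T → Feasible T → sumOver T x ℕ.≤ sumOver S x)

  Tie : Vec ℕ d → Fin d → Set
  Tie x i = Σ (Subset d) λ C → Σ (Subset d) λ D → (Optimal x C × Optimal x D) × lookup C i ≡ true × lookup D i ≡ false

-- Descent along exchanges with an optimal k-set Cs of weight F: a set whose size is off from k
-- by n and whose weight beats F by more than β per unit of size difference yields a set of size
-- exactly k ± 1 beating F by more than β. For n = 0 the hypothesis contradicts optimality.
module Descent (Δ k : ℕ) {d : ℕ} (c : Vec ℕ d) (Cs : Subset d) (Cs-optimal : Optimality.Optimal Δ k c Cs) where
  open import Data.Nat using (zero; z≤n; s≤s)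
  open import Data.Integer hiding (suc; _/_)
  open import Data.Integer.Properties using (<⇒≱; ≮⇒≥; *-zeroʳ; *-identityʳ; +-identityʳ; drop‿+≤+)
  open import Data.Fin using (Fin)
  open import Data.Fin.Subset using () renaming (∣_∣ to card)
  open import Data.Product using (Σ; proj₁; proj₂)
  open import Data.Empty using (⊥-elim)
  open import Relation.Binary.PropositionalEquality
  open import Relation.Nullary using (yes; no)
  open Exchange Δ
  open Lagrangian k c
  open LinearBounds
  open Optimality Δ k

  F : ℤ
  F = weight Cs

  Cs-sep : InM Δ Cs
  Cs-sep = proj₁ (proj₁ Cs-optimal)

  Cs-size : card Cs ≡ k
  Cs-size = proj₂ (proj₁ Cs-optimal)

  at-most-F : ∀ T → InM Δ T → card T ≡ k → weight T ≤ F
  at-most-F T T-sep T-size = +≤+ (proj₂ Cs-optimal T (T-sep , T-size))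

  Above : ℤ → Set
  Above β = Σ (Subset d) λ A → InM Δ A × card A ≡ suc k × F + β < weight A

  Below : ℤ → Set
  Below β = Σ (Subset d) λ B → InM Δ B × suc (card B) ≡ k × F < weight B + β

  -- sets of size k + (n + 1), by induction on n: keep exchanging with Cs until the kept part C
  -- beats F + β, or the remainder D reaches size k + 1
  descend-above′ : ∀ β n T → InM Δ T → card T ≡ k ℕ.+ suc n → F + β * + suc n < weight T → Above β
  descend-above′ β zero T T-sep size big =
    T , T-sep , trans size (ℕP.+-comm k 1) , subst (λ z → F + z < weight T) (*-identityʳ β) big
  descend-above′ β (suc n) T T-sep size big = via (exchange Cs T Cs-sep T-sep room)
    where
    room : card Cs ℕ.+ 2 ℕ.≤ card T
    room = subst₂ (λ x y → x ℕ.+ 2 ℕ.≤ y) (sym Cs-size) (sym size) (ℕP.+-monoʳ-≤ k (s≤s (s≤s z≤n)))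
    via : Exchanged Cs T → Above β
    via ex = decide (F + β <? weight C)
      where
      open Exchanged ex
      D-size : card D ≡ k ℕ.+ suc n
      D-size = ℕP.suc-injective (trans D-card (trans size (ℕP.+-suc k (suc n))))
      decide : Dec (F + β < weight C) → Above β
      decide (yes better) = C , C-sep , trans C-card (cong suc Cs-size) , better
      decide (no ¬better) = descend-above′ β n D D-sep D-size
        (exchange-above F β (weight T) (weight C) (weight D) (+ suc n) (cong +_ (weights c)) (≮⇒≥ ¬better) big)

  descend-above : ∀ β n T → InM Δ T → card T ≡ k ℕ.+ n → F + β * + n < weight T → Above β
  descend-above β zero T T-sep size big =
    ⊥-elim (<⇒≱ (subst (_< weight T) (trans (cong (λ z → F + z) (*-zeroʳ β)) (+-identityʳ F)) big)
                (at-most-F T T-sep (trans size (ℕP.+-identityʳ k))))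
  descend-above β (suc n) = descend-above′ β n

  descend-below′ : ∀ β n T → InM Δ T → card T ℕ.+ suc n ≡ k → F < weight T + β * + suc n → Below β
  descend-below′ β zero T T-sep size big =
    T , T-sep , trans (ℕP.+-comm 1 (card T)) size , subst (λ z → F < weight T + z) (*-identityʳ β) big
  descend-below′ β (suc n) T T-sep size big = via (exchange T Cs T-sep Cs-sep room)
    where
    room : card T ℕ.+ 2 ℕ.≤ card Cs
    room = subst (card T ℕ.+ 2 ℕ.≤_) (sym Cs-size)
             (ℕP.≤-trans (ℕP.+-monoʳ-≤ (card T) (s≤s (s≤s z≤n))) (ℕP.≤-reflexive size))
    via : Exchanged T Cs → Below β
    via ex = decide (F <? weight D + β)
      where
      open Exchanged ex
      C-size : card C ℕ.+ suc n ≡ k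
      C-size = trans (cong (ℕ._+ suc n) C-card) (trans (sym (ℕP.+-suc (card T) (suc n))) size)
      decide : Dec (F < weight D + β) → Below β
      decide (yes better) = D , D-sep , trans D-card Cs-size , better
      decide (no ¬better) = descend-below′ β n C C-sep C-size
        (exchange-below F β (weight T) (weight C) (weight D) (+ suc n) (cong +_ (weights c)) (≮⇒≥ ¬better) big)

  descend-below : ∀ β n T → InM Δ T → card T ℕ.+ n ≡ k → F < weight T + β * + n → Below β
  descend-below β zero T T-sep size big =
    ⊥-elim (<⇒≱ (subst (F <_) (trans (cong (λ z → weight T + z) (*-zeroʳ β)) (+-identityʳ (weight T))) big)
                (at-most-F T T-sep (trans (sym (ℕP.+-identityʳ (card T))) size)))
  descend-below β (suc n) = descend-below′ β n

  -- A (k+1)-set and a (k-1)-set close enough to the optimum exchange into a tie: two k-sets whose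
  -- weights add up to at least 2F, hence both optimal, one containing a position the other lacks.
  tie : ∀ μ → Above (μ - 1ℤ) → Below (μ + 1ℤ) → Σ (Fin d) (Tie c)
  tie μ (A , A-sep , A-size , A-big) (B , B-sep , B-size , B-big) =
    proj₁ witness , C , D , (optimal C-sep C-size (proj₁ both-F) , optimal D-sep D-size (proj₂ both-F)) , proj₂ witness
    where
    room : card B ℕ.+ 2 ℕ.≤ card A
    room = ℕP.≤-reflexive (trans (ℕP.+-comm (card B) 2) (trans (cong suc B-size) (sym A-size)))
    open Exchanged (exchange B A B-sep A-sep room)
    C-size : card C ≡ k
    C-size = trans C-card B-size
    D-size : card D ≡ k
    D-size = ℕP.suc-injective (trans D-card A-size)
    both-F : sumOver C c ≡ sumOver Cs c × sumOver D c ≡ sumOver Cs c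
    both-F = squeeze _ _ _ (proj₂ Cs-optimal C (C-sep , C-size)) (proj₂ Cs-optimal D (D-sep , D-size))
      (ℕP.≤-trans (drop‿+≤+ (pair-bound F μ (weight A) (weight B) A-big B-big))
                  (ℕP.≤-reflexive (trans (ℕP.+-comm (sumOver A c) (sumOver B c)) (sym (weights c)))))
    optimal : ∀ {S} → InM Δ S → card S ≡ k → sumOver S c ≡ sumOver Cs c → Optimal c S
    optimal S-sep S-size S=F = (S-sep , S-size) , λ T T-feasible → subst (sumOver T c ℕ.≤_) (sym S=F) (proj₂ Cs-optimal T T-feasible)

-- The heart of the analysis: let μ = λ̂ be the largest integer minimiser of the dual value and S
-- the chosen maximiser at μ - 1/(d + 1). If |S| > k, then S descends to a good (k+1)-set, and
-- the maximiser at μ + 1 (which has fewer than k elements since the dual value increases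
-- there) to a good (k-1)-set. If |S| < k, symmetrically with the maximiser at μ - 1, whose
-- size is at least k since μ is a minimiser. Either way the two sets exchange into a tie.
module Dichotomy (Δ k : ℕ) {d : ℕ} (c : Vec ℕ (suc d)) (Cs : Subset (suc d))
                 (Cs-optimal : Optimality.Optimal Δ k c Cs)
                 (μ : ℤ) (μ-hat : IsLambdaHat Δ k c μ)
                 (choose : ℚ → Subset (suc d)) (choose-max : ∀ λ′ → InProjLagr Δ k λ′ c (choose λ′)) where
  open import Data.Integer hiding (suc; _/_)
  open import Data.Integer.Properties
    using (≤-trans; ≤-<-trans; <-≤-trans; ≤-reflexive; <⇒≱; +-comm; +-identityʳ; *-identityʳ; *-zeroʳ; +-monoʳ-≤; i≤i+j; suc[i]≤j⇒i<j)
  open import Data.Fin using (Fin)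
  open import Data.Fin.Subset using () renaming (∣_∣ to card)
  open import Data.Product using (Σ; proj₁; proj₂)
  open import Data.Sum using (_⊎_; inj₁; inj₂)
  open import Relation.Binary.PropositionalEquality
  open import Relation.Binary using (tri<; tri≈; tri>)
  open Lagrangian k c
  open LinearBounds
  open Optimality Δ k
  open Descent Δ k c Cs Cs-optimal

  chosen : ℤ → Subset (suc d)
  chosen ν = choose (ν / 1)

  chosen-sep : ∀ ν → InM Δ (chosen ν)
  chosen-sep ν = proj₁ (choose-max (ν / 1))

  maximal : ∀ ν T → InM Δ T → L ν T ≤ L ν (chosen ν)
  maximal ν T T-sep = L-≤ ν ν T (chosen ν) (proj₂ (choose-max (ν / 1)) T T-sep)

  optimum : ∀ λ′ → OptVal Δ k λ′ c (lagr k λ′ c (choose λ′))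
  optimum λ′ = (choose λ′ , proj₁ (choose-max λ′) , refl) , proj₂ (choose-max λ′)

  -- μ minimises the dual value ...
  minimal : ∀ ν → L μ (chosen μ) ≤ L ν (chosen ν)
  minimal ν = L-≤ μ ν (chosen μ) (chosen ν) (proj₁ (μ-hat ν _ _ (optimum (μ / 1)) (optimum (ν / 1))))

  -- ... and is the largest minimiser, so the dual value increases strictly at μ + 1
  increases : L μ (chosen μ) < L (μ + 1ℤ) (chosen (μ + 1ℤ))
  increases = L-< μ (μ + 1ℤ) (chosen μ) (chosen (μ + 1ℤ)) (ℚP.≰⇒> λ le →
    <⇒≱ (suc[i]≤j⇒i<j (≤-reflexive (+-comm 1ℤ μ))) (proj₂ (μ-hat (μ + 1ℤ) _ _ (optimum (μ / 1)) (optimum _)) le))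

  -- Cs is feasible with deficit 0, so F is at most the dual value at μ
  F≤dual : F ≤ L μ (chosen μ)
  F≤dual = subst (_≤ L μ (chosen μ))
             (trans (cong (λ g → F + μ * g) (deficit-exact Cs Cs-size)) (trans (cong (λ z → F + z) (*-zeroʳ μ)) (+-identityʳ F)))
             (maximal μ Cs Cs-sep)

  S : Subset (suc d)
  S = choose (lowered μ)

  S-sep : InM Δ S
  S-sep = proj₁ (choose-max (lowered μ))

  m ν : ℤ
  m = + suc (suc d)
  ν = μ * m - 1ℤ

  S-beats-Cs : F * m + ν * 0ℤ ≤ weight S * m + ν * deficit S
  S-beats-Cs = subst (λ g → F * m + ν * g ≤ weight S * m + ν * deficit S) (deficit-exact Cs Cs-size)
                 (lowered-≤ μ Cs S (proj₂ (choose-max (lowered μ)) Cs Cs-sep))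

  -- |S| > k: S descends to a (k+1)-set, the maximiser T₊ at μ + 1 has fewer than k elements
  -- (the dual value increases from μ to μ + 1) and descends to a (k-1)-set
  too-large : ∀ n → card S ≡ k ℕ.+ suc n → Σ (Fin (suc d)) (Tie c)
  too-large n size = tie μ above below
    where
    above : Above (μ - 1ℤ)
    above = descend-above (μ - 1ℤ) (suc n) S S-sep size
              (lowered-above F (weight S) μ d n (subst (λ g → F * m + ν * 0ℤ ≤ weight S * m + ν * g) (deficit-excess S size) S-beats-Cs))
    T₊ : Subset (suc d)
    T₊ = chosen (μ + 1ℤ)
    short : card T₊ ℕ.< k
    short = short-of-k T₊ (deficit-positive (weight T₊) (deficit T₊) μ _ (maximal μ T₊ (chosen-sep (μ + 1ℤ))) increases)
    n′ : ℕ
    n′ = proj₁ (ℕP.m≤n⇒∃[o]m+o≡n (ℕP.<⇒≤ short))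
    T₊-size : card T₊ ℕ.+ n′ ≡ k
    T₊-size = proj₂ (ℕP.m≤n⇒∃[o]m+o≡n (ℕP.<⇒≤ short))
    below : Below (μ + 1ℤ)
    below = descend-below (μ + 1ℤ) n′ T₊ (chosen-sep (μ + 1ℤ)) T₊-size
              (subst (λ g → F < weight T₊ + (μ + 1ℤ) * g) (deficit-shortfall T₊ T₊-size) (≤-<-trans F≤dual increases))

  -- |S| < k: S descends to a (k-1)-set B, the maximiser T₋ at μ - 1 has at least k elements
  -- (μ is a minimiser), and F < L μ B ≤ dual(μ) ≤ dual(μ - 1) lets T₋ descend to a (k+1)-set
  too-small : ∀ n → card S ℕ.+ suc n ≡ k → Σ (Fin (suc d)) (Tie c)
  too-small n size = tie μ above (B , B-sep , B-size , <-≤-trans B-big (+-monoʳ-≤ (weight B) (i≤i+j μ 1ℤ)))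
    where
    below : Below μ
    below = descend-below μ (suc n) S S-sep size
              (lowered-below F (weight S) μ (suc d) n (subst (λ g → F * m + ν * 0ℤ ≤ weight S * m + ν * g) (deficit-shortfall S size) S-beats-Cs))
    B : Subset (suc d)
    B = proj₁ below
    B-sep : InM Δ B
    B-sep = proj₁ (proj₂ below)
    B-size : suc (card B) ≡ k
    B-size = proj₁ (proj₂ (proj₂ below))
    B-big : F < weight B + μ
    B-big = proj₂ (proj₂ (proj₂ below))
    T₋ : Subset (suc d)
    T₋ = chosen (μ - 1ℤ)
    long : k ℕ.≤ card T₋
    long = at-least-k T₋ (deficit-nonpositive (weight T₋) (deficit T₋) μ _ (maximal μ T₋ (chosen-sep (μ - 1ℤ))) (minimal (μ - 1ℤ)))
    n′ : ℕ
    n′ = proj₁ (ℕP.m≤n⇒∃[o]m+o≡n long)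
    T₋-size : k ℕ.+ n′ ≡ card T₋
    T₋-size = proj₂ (ℕP.m≤n⇒∃[o]m+o≡n long)
    L-B : L μ B ≡ weight B + μ
    L-B = trans (cong (λ g → weight B + μ * g) (deficit-shortfall B (trans (ℕP.+-comm (card B) 1) B-size)))
                (cong (λ z → weight B + z) (*-identityʳ μ))
    F<dual₋ : F < L (μ - 1ℤ) T₋
    F<dual₋ = <-≤-trans B-big (≤-trans (≤-reflexive (sym L-B)) (≤-trans (maximal μ B B-sep) (minimal (μ - 1ℤ))))
    above : Above (μ - 1ℤ)
    above = descend-above (μ - 1ℤ) n′ T₋ (chosen-sep (μ - 1ℤ)) (sym T₋-size)
              (move-term F (weight T₋) (μ - 1ℤ) (+ n′)
                (subst (λ g → F < weight T₋ + (μ - 1ℤ) * g) (deficit-excess T₋ (sym T₋-size)) F<dual₋))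

  success-or-tie : card S ≡ k ⊎ Σ (Fin (suc d)) (Tie c)
  success-or-tie with ℕP.<-cmp (card S) k
  ... | tri≈ _ eq _ = inj₁ eq
  ... | tri< lt _ _ = let n , eq = ℕP.m≤n⇒∃[o]m+o≡n lt in inj₂ (too-small n (trans (ℕP.+-suc (card S) n) eq))
  ... | tri> _ _ gt = let n , eq = ℕP.m≤n⇒∃[o]m+o≡n gt in inj₂ (too-large n (sym (trans (ℕP.+-suc k n) eq)))

module Enumeration (Δ k : ℕ) {d : ℕ} where
  import Data.Bool.Properties as BoolP
  open import Data.Nat
  open import Data.List using (List; []; _∷_; _++_; map)
  open import Data.List.Membership.Propositional using (_∈_)
  open import Data.List.Membership.Propositional.Properties using (∈-++⁺ˡ; ∈-++⁺ʳ; ∈-map⁺; ∈-filter⁺)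
  import Data.List.Relation.Unary.All as All
  open import Data.List.Relation.Unary.All.Properties using (all-filter)
  open import Data.List.Relation.Unary.Any using (here)
  open import Data.List.Extrema.Nat using (argmax; argmax-all; f[xs]≤f[argmax])
  open import Data.Vec using (lookup) renaming ([] to []ᵥ; _∷_ to _∷ᵥ_)
  open import Data.Fin using (toℕ)
  import Data.Fin.Properties as FinP
  open import Data.Fin.Subset using () renaming (∣_∣ to card)
  open import Data.Fin.Subset.Properties using (_∈?_; anySubset?)
  open import Data.Product using (Σ)
  open import Relation.Binary.PropositionalEquality
  open import Relation.Nullary using (yes; no)
  open import Relation.Nullary.Decidable using (_×-dec_; _→-dec_; ¬?; decidable-stable)
  open import Relation.Unary using (Decidable)
  open Optimality Δ k

  allSubsets : ∀ n → List (Subset n)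
  allSubsets zero = []ᵥ ∷ []
  allSubsets (suc n) = map (true ∷ᵥ_) (allSubsets n) ++ map (false ∷ᵥ_) (allSubsets n)

  ∈-allSubsets : ∀ {n} (S : Subset n) → S ∈ allSubsets n
  ∈-allSubsets []ᵥ = here refl
  ∈-allSubsets (true ∷ᵥ S) = ∈-++⁺ˡ (∈-map⁺ (true ∷ᵥ_) (∈-allSubsets S))
  ∈-allSubsets {suc n} (false ∷ᵥ S) = ∈-++⁺ʳ (map (true ∷ᵥ_) (allSubsets n)) (∈-map⁺ (false ∷ᵥ_) (∈-allSubsets S))

  everySubset? : {P : Subset d → Set} → Decidable P → Dec (∀ S → P S)
  everySubset? P? with anySubset? (¬? ∘ P?)
  ... | yes (S , ¬PS) = no (λ all → ¬PS (all S))
  ... | no ¬∃ = yes (λ S → decidable-stable (P? S) (λ ¬PS → ¬∃ (S , ¬PS)))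

  InM? : (S : Subset d) → Dec (InM Δ S)
  InM? S = FinP.all? λ i → FinP.all? λ j →
    (i ∈? S) →-dec ((j ∈? S) →-dec ((¬? (i FinP.≟ j)) →-dec (Δ ≤? ∣ toℕ i - toℕ j ∣)))

  Feasible? : Decidable Feasible
  Feasible? S = InM? S ×-dec (card S ≟ k)

  Optimal? : ∀ x → Decidable (Optimal x)
  Optimal? x S = Feasible? S ×-dec everySubset? (λ T → Feasible? T →-dec (sumOver T x ≤? sumOver S x))

  Tie? : ∀ x → Decidable (Tie x)
  Tie? x i = anySubset? λ C → anySubset? λ D →
    (Optimal? x C ×-dec Optimal? x D) ×-dec (lookup C i BoolP.≟ true) ×-dec (lookup D i BoolP.≟ false)

  optimal-exists : ∀ x → (Σ (Subset d) Feasible) → Σ (Subset d) (Optimal x)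
  optimal-exists x (Ω , Ω-feasible) = best , argmax-all w Ω-feasible (all-filter Feasible? (allSubsets d)) , heaviest
    where
    w : Subset d → ℕ
    w S = sumOver S x
    best : Subset d
    best = argmax w Ω (filter Feasible? (allSubsets d))
    heaviest : ∀ T → Feasible T → w T ≤ w best
    heaviest T T-feasible = All.lookup (f[xs]≤f[argmax] Ω (filter Feasible? (allSubsets d)))
                              (∈-filter⁺ Feasible? (∈-allSubsets T) T-feasible)

-- Changing X only in coordinate i shifts the weight of a set
-- containing i by the change of X_i and leaves the other weights alone; hence, once the other
-- coordinates are fixed, at most one value of X_i produces a tie at i.
module Perturbation (Δ k : ℕ) {d : ℕ} (c : Vec ℕ d) where
  open import Data.Bool using (if_then_else_)
  open import Data.Nat
  open import Data.Nat.Properties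
  open import Data.List using (allFin)
  open import Data.Vec using (lookup)
  import Data.Vec.Properties as VecP
  open import Data.Fin using (Fin; toℕ)
  import Data.Fin.Properties as FinP
  open import Data.Product using (proj₁; proj₂)
  open import Data.Empty using (⊥-elim)
  open import Relation.Binary.PropositionalEquality
  open import Relation.Nullary using (¬_)
  open import Relation.Binary using (tri<; tri≈; tri>)
  open Optimality Δ k
  open ListSums

  Agree : Fin d → (X Y : Vec (Fin (d ^ 3)) d) → Set
  Agree i X Y = ∀ j → j ≢ i → lookup X j ≡ lookup Y j

  private
    entry : ∀ X j → lookup (perturb c X) j ≡ d ^ 4 * lookup c j + toℕ (lookup X j)
    entry X j = VecP.lookup-zipWith (λ cj xj → d ^ 4 * cj + toℕ xj) j c X

    term : Subset d → Vec (Fin (d ^ 3)) d → Fin d → ℕ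
    term S X j = if lookup S j then lookup (perturb c X) j else 0

    weight-shift : ∀ S X Y i → Agree i X Y → sumOver S (perturb c X) + term S Y i ≡ sumOver S (perturb c Y) + term S X i
    weight-shift S X Y i agree =
      subst₂ (λ a b → a + term S Y i ≡ b + term S X i) (sym (as-ΣFin X)) (sym (as-ΣFin Y))
        (ΣFin-change d (term S X) (term S Y) i (λ j j≢i →
           cong (λ z → if lookup S j then z else 0)
             (trans (entry X j) (trans (cong (λ x → d ^ 4 * lookup c j + toℕ x) (agree j j≢i)) (sym (entry Y j))))))
      where
      as-ΣFin : ∀ Z → sumOver S (perturb c Z) ≡ ΣFin d (term S Z)
      as-ΣFin Z = trans (sum-map (term S Z) (allFin d)) (sumBy-tabulate (term S Z) (λ j → j))

  weight-without : ∀ S X Y i → Agree i X Y → lookup S i ≡ false → sumOver S (perturb c X) ≡ sumOver S (perturb c Y)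
  weight-without S X Y i agree i∉S =
    +-cancelʳ-≡ 0 _ _ (subst₂ (λ a b → sumOver S (perturb c X) + a ≡ sumOver S (perturb c Y) + b)
                        (cong (λ b → if b then _ else 0) i∉S) (cong (λ b → if b then _ else 0) i∉S) (weight-shift S X Y i agree))

  weight-with : ∀ S X Y i → Agree i X Y → lookup S i ≡ true
              → sumOver S (perturb c X) + toℕ (lookup Y i) ≡ sumOver S (perturb c Y) + toℕ (lookup X i)
  weight-with S X Y i agree i∈S = +-cancelˡ-≡ (d ^ 4 * lookup c i) _ _ (begin
    d ^ 4 * lookup c i + (sumOver S (perturb c X) + toℕ (lookup Y i)) ≡⟨ shuffle (d ^ 4 * lookup c i) (sumOver S (perturb c X)) _ ⟩
    sumOver S (perturb c X) + (d ^ 4 * lookup c i + toℕ (lookup Y i)) ≡⟨ subst₂ (λ a b → sumOver S (perturb c X) + a ≡ sumOver S (perturb c Y) + b)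
                                                                           (at Y) (at X) (weight-shift S X Y i agree) ⟩
    sumOver S (perturb c Y) + (d ^ 4 * lookup c i + toℕ (lookup X i)) ≡⟨ sym (shuffle (d ^ 4 * lookup c i) (sumOver S (perturb c Y)) _) ⟩
    d ^ 4 * lookup c i + (sumOver S (perturb c Y) + toℕ (lookup X i)) ∎)
    where
    open ≡-Reasoning
    at : ∀ Z → term S Z i ≡ d ^ 4 * lookup c i + toℕ (lookup Z i)
    at Z = trans (cong (λ b → if b then lookup (perturb c Z) i else 0) i∈S) (entry Z i)
    shuffle : ∀ a b e → a + (b + e) ≡ b + (a + e)
    shuffle a b e = trans (sym (+-assoc a b e)) (trans (cong (_+ e) (+-comm a b)) (+-assoc b a e))

  -- If X_i < Y_i, a set U ∋ i optimal for X gets strictly heavier under Y, yet stays below the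
  -- weight of a set V ∌ i optimal for Y, whose weight is the same under X and Y: no tie at i for both.
  no-two-ties : ∀ X Y i → Tie (perturb c X) i → Tie (perturb c Y) i → Agree i X Y → ¬ (toℕ (lookup X i) < toℕ (lookup Y i))
  no-two-ties X Y i (U , _ , (U-optimal , _) , i∈U , _) (_ , V , (_ , V-optimal) , _ , i∉V) agree Xi<Yi =
    <-irrefl refl (<-≤-trans heavier
      (≤-trans (≤-reflexive (weight-with U X Y i agree i∈U)) (+-monoˡ-≤ (toℕ (lookup X i)) U-lighter)))
    where
    heavier : sumOver U (perturb c X) + toℕ (lookup X i) < sumOver U (perturb c X) + toℕ (lookup Y i)
    heavier = +-monoʳ-< _ Xi<Yi
    U-lighter : sumOver U (perturb c Y) ≤ sumOver U (perturb c X)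
    U-lighter = ≤-trans (proj₂ V-optimal U (proj₁ U-optimal))
                  (≤-trans (≤-reflexive (sym (weight-without V X Y i agree i∉V))) (proj₂ U-optimal V (proj₁ V-optimal)))

  ties-pin : ∀ i X Y → Tie (perturb c X) i → Tie (perturb c Y) i → Agree i X Y → lookup X i ≡ lookup Y i
  ties-pin i X Y tieX tieY agree with <-cmp (toℕ (lookup X i)) (toℕ (lookup Y i))
  ... | tri< lt _ _ = ⊥-elim (no-two-ties X Y i tieX tieY agree lt)
  ... | tri≈ _ eq _ = FinP.toℕ-injective eq
  ... | tri> _ _ gt = ⊥-elim (no-two-ties Y X i tieY tieX (λ j j≢i → sym (agree j j≢i)) gt)

module Sampling where
  open import Data.Nat
  open import Data.Nat.Properties
  open import Data.List using (map; allFin)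
  import Data.List.Properties as ListP
  open import Data.Vec using (lookup) renaming (_∷_ to _∷ᵥ_)
  open import Data.Fin using (Fin) renaming (zero to fz; suc to fs)
  import Data.Fin.Properties as FinP
  open import Data.Empty using (⊥-elim)
  open import Relation.Binary.PropositionalEquality
  open import Relation.Nullary using (yes; no)
  open import Relation.Unary using (Decidable)
  open ListSums

  allVecs-sum : ∀ n m (f : Vec (Fin m) (suc n) → ℕ)
              → sumBy f (allVecs (suc n) m) ≡ sumBy (λ x → sumBy (λ v → f (x ∷ᵥ v)) (allVecs n m)) (allFin m)
  allVecs-sum n m f = trans (sumBy-concatMap f (λ x → map (x ∷ᵥ_) (allVecs n m)) (allFin m))
                            (sumBy-cong (allFin m) (λ x → sumBy-map f (x ∷ᵥ_) (allVecs n m)))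

  sumBy-allFin-const : ∀ m b → sumBy (λ (_ : Fin m) → b) (allFin m) ≡ m * b
  sumBy-allFin-const m b = trans (sumBy-const b (allFin m)) (cong (_* b) (ListP.length-tabulate {n = m} (λ i → i)))

  sample-count : ∀ n m → sumBy (λ _ → 1) (allVecs n m) ≡ m ^ n
  sample-count zero m = refl
  sample-count (suc n) m = trans (allVecs-sum n m (λ _ → 1))
    (trans (sumBy-cong (allFin m) (λ _ → sample-count n m)) (sumBy-allFin-const m (m ^ n)))

  Pinned : ∀ {n m} → Fin n → (Vec (Fin m) n → Set) → Set
  Pinned i P = ∀ X Y → P X → P Y → (∀ j → j ≢ i → lookup X j ≡ lookup Y j) → lookup X i ≡ lookup Y i

  at-most-one : ∀ m {Q : Fin m → Set} (Q? : Decidable Q) → (∀ x y → Q x → Q y → x ≡ y)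
              → sumBy (indicator ∘ Q?) (allFin m) ≤ 1
  at-most-one m Q? unique = subst (_≤ 1) (sym (sumBy-tabulate (indicator ∘ Q?) (λ i → i))) (on-ΣFin m Q? unique)
    where
    none : ∀ m (f : Fin m → ℕ) → (∀ j → f j ≡ 0) → ΣFin m f ≡ 0
    none zero f zeros = refl
    none (suc m) f zeros = cong₂ _+_ (zeros fz) (none m (f ∘ fs) (zeros ∘ fs))
    on-ΣFin : ∀ m {Q : Fin m → Set} (Q? : Decidable Q) → (∀ x y → Q x → Q y → x ≡ y) → ΣFin m (indicator ∘ Q?) ≤ 1
    on-ΣFin zero Q? unique = z≤n
    on-ΣFin (suc m) Q? unique with Q? fz
    ... | yes q₀ = ≤-reflexive (cong suc (none m _ rest))
      where
      rest : ∀ j → indicator (Q? (fs j)) ≡ 0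
      rest j with Q? (fs j)
      ... | yes qj with () ← unique _ _ q₀ qj
      ... | no _ = refl
    ... | no _ = on-ΣFin m (Q? ∘ fs) (λ x y qx qy → FinP.suc-injective (unique _ _ qx qy))

  pinned-count : ∀ n m (i : Fin (suc n)) {P : Vec (Fin m) (suc n) → Set} (P? : Decidable P) → Pinned i P
               → sumBy (indicator ∘ P?) (allVecs (suc n) m) ≤ m ^ n
  pinned-count n m fz {P} P? pinned = begin
    sumBy (indicator ∘ P?) (allVecs (suc n) m)                                   ≡⟨ allVecs-sum n m _ ⟩
    sumBy (λ x → sumBy (λ v → indicator (P? (x ∷ᵥ v))) (allVecs n m)) (allFin m) ≡⟨ sumBy-swap (λ x v → indicator (P? (x ∷ᵥ v))) (allFin m) (allVecs n m) ⟩
    sumBy (λ v → sumBy (λ x → indicator (P? (x ∷ᵥ v))) (allFin m)) (allVecs n m) ≤⟨ sumBy-mono (allVecs n m) one-head ⟩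
    sumBy (λ _ → 1) (allVecs n m)                                                ≡⟨ sample-count n m ⟩
    m ^ n                                                                        ∎
    where
    open ≤-Reasoning
    one-head : ∀ v → sumBy (λ x → indicator (P? (x ∷ᵥ v))) (allFin m) ≤ 1
    one-head v = at-most-one m (λ x → P? (x ∷ᵥ v)) (λ x y px py → pinned _ _ px py same-tail)
      where
      same-tail : ∀ {x y} j → j ≢ fz → lookup (x ∷ᵥ v) j ≡ lookup (y ∷ᵥ v) j
      same-tail fz j≢0 = ⊥-elim (j≢0 refl)
      same-tail (fs j) _ = refl
  pinned-count (suc n) m (fs i) {P} P? pinned = begin
    sumBy (indicator ∘ P?) (allVecs (suc (suc n)) m)                                     ≡⟨ allVecs-sum (suc n) m _ ⟩
    sumBy (λ x → sumBy (λ v → indicator (P? (x ∷ᵥ v))) (allVecs (suc n) m)) (allFin m)  ≤⟨ sumBy-mono (allFin m) per-head ⟩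
    sumBy (λ _ → m ^ n) (allFin m)                                                       ≡⟨ sumBy-allFin-const m (m ^ n) ⟩
    m * m ^ n                                                                            ∎
    where
    open ≤-Reasoning
    per-head : ∀ x → sumBy (λ v → indicator (P? (x ∷ᵥ v))) (allVecs (suc n) m) ≤ m ^ n
    per-head x = pinned-count n m i (λ v → P? (x ∷ᵥ v)) (λ v w pv pw agree →
      pinned (x ∷ᵥ v) (x ∷ᵥ w) pv pw (λ { fz _ → refl ; (fs j) j≢i → agree j (j≢i ∘ cong fs) }))

-- If each of T samples succeeds or is one of at most (n + 1) Q failures, and (n + 1)² Q ≤ T,
-- then the success fraction G / T is at least 1 - 1/(n + 1).
probability-bound : ∀ n T G Q → T ℕ.≤ G ℕ.+ suc n ℕ.* Q → suc n ℕ.* suc n ℕ.* Q ℕ.≤ T → n ℕ.* T ℕ.≤ suc n ℕ.* G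
probability-bound n T G Q T≤ small = ℕP.+-cancelˡ-≤ T (n ℕ.* T) (suc n ℕ.* G) (begin
  suc n ℕ.* T                                 ≤⟨ ℕP.*-monoʳ-≤ (suc n) T≤ ⟩
  suc n ℕ.* (G ℕ.+ suc n ℕ.* Q)               ≡⟨ ℕP.*-distribˡ-+ (suc n) G (suc n ℕ.* Q) ⟩
  suc n ℕ.* G ℕ.+ suc n ℕ.* (suc n ℕ.* Q)     ≡⟨ cong (suc n ℕ.* G ℕ.+_) (sym (ℕP.*-assoc (suc n) (suc n) Q)) ⟩
  suc n ℕ.* G ℕ.+ suc n ℕ.* suc n ℕ.* Q       ≤⟨ ℕP.+-monoʳ-≤ (suc n ℕ.* G) small ⟩
  suc n ℕ.* G ℕ.+ T                           ≡⟨ ℕP.+-comm (suc n ℕ.* G) T ⟩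
  T ℕ.+ suc n ℕ.* G                           ∎)
  where open ℕP.≤-Reasoning

-- One run of the loop body, for a vector c of length d = n + 1. It fails on a sample X only if
-- the perturbed weights tie at some position i, and ties at i pin X_i; this bounds the failures.
module Analysis (n k Δ : ℕ) (c : Vec ℕ (suc n)) (feasible : Σ (Subset (suc n)) (Optimality.Feasible Δ k))
                (lamHat : Vec ℕ (suc n) → ℤ) (lamHat-ok : ∀ c̃ → IsLambdaHat Δ k c̃ (lamHat c̃))
                (choose : Vec ℕ (suc n) → ℚ → Subset (suc n))
                (choose-ok : ∀ c̃ λ′ → InProjLagr Δ k λ′ c̃ (choose c̃ λ′)) where
  open import Data.Nat using (_≤_; _+_; _*_)
  open import Data.Fin using (Fin)
  open import Data.List using (List; allFin)
  open import Data.List.Membership.Propositional.Properties using (∈-allFin)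
  open import Data.Product using (Σ; proj₁; proj₂)
  open import Data.Sum using (_⊎_; [_,_]′)
  open import Relation.Binary.PropositionalEquality using (sym; cong₂)
  open Optimality Δ k
  open Enumeration Δ k {suc n}
  open Perturbation Δ k c
  open Sampling
  open ListSums

  d R : ℕ
  d = suc n
  R = d ^ 3

  samples : List (Vec (Fin R) d)
  samples = allVecs d R

  output : Vec (Fin R) d → Subset d
  output X = choose (perturb c X) ((lamHat (perturb c X) / 1) ℚ.- (ℤ.+ 1 / suc d))

  success? : ∀ X → Dec (∣ output X ∣ ≡ k)
  success? X = ∣ output X ∣ ≟ k

  succeeds-or-ties : ∀ X → ∣ output X ∣ ≡ k ⊎ Σ (Fin d) (Tie (perturb c X))
  succeeds-or-ties X = Dichotomy.success-or-tie Δ k c̃ (proj₁ best) (proj₂ best)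
                         (lamHat c̃) (lamHat-ok c̃) (choose c̃) (choose-ok c̃)
    where
    c̃ : Vec ℕ d
    c̃ = perturb c X
    best : Σ (Subset d) (Optimal c̃)
    best = optimal-exists c̃ feasible

  tie-count : Vec (Fin R) d → ℕ
  tie-count X = sumBy (λ i → indicator (Tie? (perturb c X) i)) (allFin d)

  tie-covered : ∀ X i → Tie (perturb c X) i → 1 ≤ tie-count X
  tie-covered X i tie = ℕP.≤-trans (ℕP.≤-reflexive (sym (indicator-yes (Tie? (perturb c X) i) tie)))
                          (sumBy-member (λ j → indicator (Tie? (perturb c X) j)) (allFin d) (∈-allFin i))

  covered : ∀ X → 1 ≤ indicator (success? X) + tie-count X
  covered X = [ (λ succeeded → ℕP.≤-trans (ℕP.≤-reflexive (sym (indicator-yes (success? X) succeeded)))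
                                 (ℕP.m≤m+n (indicator (success? X)) (tie-count X)))
              , (λ (i , tie) → ℕP.≤-trans (tie-covered X i tie) (ℕP.m≤n+m (tie-count X) (indicator (success? X)))) ]′
              (succeeds-or-ties X)

  successes : ℕ
  successes = length (filter success? samples)

  failures-bound : R ^ d ≤ successes + d * R ^ n
  failures-bound = begin
    R ^ d                                                                 ≡⟨ sym (sample-count d R) ⟩
    sumBy (λ _ → 1) samples                                               ≤⟨ sumBy-mono samples covered ⟩
    sumBy (λ X → indicator (success? X) + tie-count X) samples            ≡⟨ sumBy-+ (indicator ∘ success?) tie-count samples ⟩
    sumBy (indicator ∘ success?) samples + sumBy tie-count samples        ≡⟨ cong₂ _+_ (sym (length-filter success? samples)) (sumBy-swap tie samples (allFin d)) ⟩
    successes + sumBy (λ i → sumBy (λ X → tie X i) samples) (allFin d)    ≤⟨ ℕP.+-monoʳ-≤ successes (sumBy-mono (allFin d) ties-rare) ⟩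
    successes + sumBy (λ _ → R ^ n) (allFin d)                            ≡⟨ cong (successes +_) (sumBy-allFin-const d (R ^ n)) ⟩
    successes + d * R ^ n                                                 ∎
    where
    open ℕP.≤-Reasoning
    tie : Vec (Fin R) d → Fin d → ℕ
    tie X i = indicator (Tie? (perturb c X) i)
    ties-rare : ∀ i → sumBy (λ X → tie X i) samples ≤ R ^ n
    ties-rare i = pinned-count n R i (λ X → Tie? (perturb c X) i) (ties-pin i)

lemma3 : (d k Δ : ℕ) (c : Vec ℕ d)
         → (∃ λ (Ω : Subset d) → InM Δ Ω × ∣ Ω ∣ ≡ k)
         → (lamHat : Vec ℕ d → ℤ)
         → ((c̃ : Vec ℕ d) → IsLambdaHat Δ k c̃ (lamHat c̃))
         → (choose : Vec ℕ d → ℚ → Subset d)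
         → ((c̃ : Vec ℕ d) (λ′ : ℚ) → InProjLagr Δ k λ′ c̃ (choose c̃ λ′))
         → (d ∸ 1) ℕ.* (d ^ 3) ^ d
           ℕ.≤ d ℕ.* length (filter
                 (λ X → ∣ choose (perturb c X)
                             ((lamHat (perturb c X) / 1) ℚ.- (ℤ.+ 1 / suc d)) ∣ ≟ k)
                 (allVecs d (d ^ 3)))
lemma3 ℕ.zero k Δ c feasible lamHat lamHat-ok choose choose-ok = ℕ.z≤n
lemma3 (suc n) k Δ c feasible lamHat lamHat-ok choose choose-ok =
  probability-bound n (R ^ d) successes (R ^ n) failures-bound (ℕP.*-monoˡ-≤ (R ^ n) d²≤d³)
  where
  open Analysis n k Δ c feasible lamHat lamHat-ok choose choose-ok
  d²≤d³ : d ℕ.* d ℕ.≤ R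
  d²≤d³ = ℕP.*-monoʳ-≤ d (ℕP.m≤m*n d (d ℕ.* 1))
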